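{- Let $m,n\ge 2$ be integers, let $p$ be a prime number, and put $k:=\nu_p(n)$. Let $S_m^n:=\{x_1^n+\cdots+x_m^n : x_1,\dots,x_m\in\mathbb{Z}_{\ge0}\}$ and $R(S_m^n):=\{a/b: a,b\in S_m^n,\ b\neq0\}$. Then: (a) If $m\ge\theta(n,p^{2k+1})$, then $R(S_m^n)$ is dense in $\mathbb{Q}_p$. (b) If $m<\theta(n,p^{2k+1})$ and $(n,p)\notin\{(2,2),(4,2),(8,2),(16,2)\}$, then $R(S_m^n)$ is not dense in $\mathbb{Q}_p$. (c) $R(S_m^2)$ is dense in $\mathbb{Q}_2$ if and only if $m\ge3$. (d) $R(S_m^4)$ is dense in $\mathbb{Q}_2$ if and only if $m\ge8$. (e) $R(S_m^8)$ is dense in $\mathbb{Q}_2$ if and only if $m\ge16$. (f) $R(S_m^{16})$ is dense in $\mathbb{Q}_2$ if and only if $m\ge64$.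
   Context: $\nu_p$ denotes the $p$-adic valuation. For integers $n,b\ge2$, $\theta(n,b)$ is the smallest positive integer $g$ such that the congruence $X_1^n+\cdots+X_g^n\equiv 0\pmod b$ has an integer solution $(X_1,\dots,X_g)$ with at least one of $X_1,\dots,X_g$ coprime to $b$. -}

module Defs where

open import Data.Nat as ℕ using (ℕ; zero; suc; _≤_; _<_; NonZero)
open import Data.Nat.Divisibility using (_∣_)
open import Data.Nat.Coprimality using (Coprime)
open import Data.Fin using (Fin)
import Data.Fin as Fin
open import Data.Integer as ℤ using (ℤ; +_)
import Data.Integer.Divisibility as ℤD
open import Data.Rational as ℚ using (ℚ)
open import Data.Product using (Σ; _×_; ∃)
open import Relation.Nullary using (¬_)
open import Relation.Binary.PropositionalEquality using (_≡_)

sumℕ : ∀ m → (Fin m → ℕ) → ℕ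
sumℕ zero    f = 0
sumℕ (suc m) f = f Fin.zero ℕ.+ sumℕ m (λ i → f (Fin.suc i))

sumℤ : ∀ m → (Fin m → ℤ) → ℤ
sumℤ zero    f = + 0
sumℤ (suc m) f = f Fin.zero ℤ.+ sumℤ m (λ i → f (Fin.suc i))

IsValuation : ℕ → ℕ → ℕ → Set
IsValuation p n k = (p ℕ.^ k ∣ n) × ¬ (p ℕ.^ suc k ∣ n)

InS : ℕ → ℕ → ℕ → Set
InS m n a = Σ (Fin m → ℕ) λ x → a ≡ sumℕ m (λ i → x i ℕ.^ n)

InR : ℕ → ℕ → ℚ → Set
InR m n r = Σ ℕ λ a → Σ ℕ λ b → InS m n a × InS m n b ×
  Σ (NonZero b) λ nz → r ≡ (+ a ℚ./ b) {{nz}}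

ValAtLeast : ℕ → ℕ → ℚ → Set
ValAtLeast p N q = (p ℕ.^ N ∣ ℤ.∣ ℚ.numerator q ∣) × ¬ (p ∣ ℚ.denominatorℕ q)

-- R(S_m^n) is dense in ℚ_p  (ℚ is dense in ℚ_p, so it suffices that
-- every rational is a p-adic limit of elements of R(S_m^n))
DenseInQp : ℕ → ℕ → ℕ → Set
DenseInQp p m n = ∀ (x : ℚ) (N : ℕ) → Σ ℚ λ r → InR m n r × ValAtLeast p N (r ℚ.- x)

Solvable : ℕ → ℕ → ℕ → Set
Solvable n b g = Σ (Fin g → ℤ) λ X →
  ((+ b) ℤD.∣ sumℤ g (λ i → X i ℤ.^ n)) × ∃ λ i → Coprime ℤ.∣ X i ∣ b

IsTheta : ℕ → ℕ → ℕ → Set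
IsTheta n b t = (1 ≤ t) × Solvable n b t × (∀ g → 1 ≤ g → g < t → ¬ Solvable n b g)

{-# OPTIONS --safe #-}
-- By Hensel's lemma a p-adic unit that is an n-th power modulo
-- p^(2k+1) is an n-th power in ℤ_p. So if θ ≤ m, a vanishing sum of θ n-th powers modulo p^(2k+1)
-- with a unit base can be corrected to represent any X·p^(n(2k+1)) p-adically; a rational x = c/d is
-- then the limit of a/(d^n·p^(n(2k+1))) with a ∈ S_m^n approximating c·d^(n-1)·p^(n(2k+1)).
-- If m < θ, no sum of m n-th powers with a unit base is divisible by p^(2k+1), so every nonzero
-- element of S_m^n has valuation n·e + d with d < 2k+1. For even n outside the exceptional cases
-- 2(2k+1) ≤ n (odd n has θ ≤ 2), hence ν(a) ≠ 2k+1 + ν(b) and a/b never approaches -p^(2k+1).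
-- For p = 2 and n = 2, 4, 8, 16 the same two mechanisms are fed with explicit residues of n-th
-- powers modulo small powers of 2, checked by decision procedures; for n = 2, 4 the obstruction
-- sits at -1 instead.
module Submission where

open import Data.Empty using (⊥-elim)
open import Data.Fin.Base using (Fin; zero; suc)
open import Data.Fin.Properties using (all?; ¬∀⟶∃¬)
open import Data.Integer.Base as ℤ using (ℤ; +_; -[1+_])
import Data.Integer.Divisibility.Signed as ℤ
import Data.Integer.DivMod as ℤ
import Data.Integer.Properties as ℤ
open import Data.Nat.Base as ℕ using (ℕ; zero; suc; NonZero; z≤n; s≤s; _≤_; _<_)
open import Data.Nat.Coprimality as Coprime using (Coprime)
import Data.Nat.Divisibility as ℕ
import Data.Nat.DivMod as ℕ
open import Data.Nat.GCD using (module Bézout)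
open import Data.Nat.Induction using (<-wellFounded)
open import Data.Nat.Primality
import Data.Nat.Properties as ℕ
open import Data.Product using (Σ; ∃-syntax; _×_; _,_; proj₁; proj₂)
open import Data.Rational.Base as ℚ using (ℚ; mkℚ)
import Data.Rational.Properties as ℚ
import Data.Rational.Unnormalised.Base as ℚᵘ
import Data.Rational.Unnormalised.Properties as ℚᵘ
open import Data.Sum using (_⊎_; inj₁; inj₂)
open import Data.Unit using (tt)
open import Data.Vec.Functional using (_∷_; updateAt)
open import Function.Base using (_∘_; const; it)
open import Function.Bundles using (_⇔_; mk⇔)
open import Induction.WellFounded using (Acc; acc)
open import Relation.Binary.Definitions using (tri<; tri≈; tri>)
open import Relation.Binary.PropositionalEquality
open import Relation.Nullary using (¬_; yes; no; Dec)
open import Relation.Nullary.Decidable using (_×-dec_; _⊎-dec_; _→-dec_; toWitness)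
open import Defs

module _ where
  open import Data.Nat.Base using (_+_; _*_; _^_; _∸_)
  open import Data.Nat.Divisibility using (_∣_; divides)
  open import Data.Nat.Tactic.RingSolver using (solve-∀)

  coprime-* : ∀ {a b c} → Coprime a b → Coprime a c → Coprime a (b * c)
  coprime-* a⊥b a⊥c (d∣a , d∣bc) =
    a⊥c (d∣a , Coprime.coprime-divisor (λ (e∣d , e∣b) → a⊥b (ℕ.∣-trans e∣d d∣a , e∣b)) d∣bc)

  ^-monoʳ-∣ : ∀ p {m n} → m ≤ n → p ^ m ∣ p ^ n
  ^-monoʳ-∣ p {m} {n} m≤n = divides (p ^ (n ∸ m)) (begin
    p ^ n                 ≡⟨ cong (p ^_) (ℕ.m+[n∸m]≡n m≤n) ⟨
    p ^ (m + (n ∸ m))     ≡⟨ ℕ.^-distribˡ-+-* p m (n ∸ m) ⟩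
    p ^ m * p ^ (n ∸ m)   ≡⟨ ℕ.*-comm (p ^ m) _ ⟩
    p ^ (n ∸ m) * p ^ m   ∎)
    where open ≡-Reasoning

  ^-distribʳ-* : ∀ a b n → (a * b) ^ n ≡ a ^ n * b ^ n
  ^-distribʳ-* a b zero    = refl
  ^-distribʳ-* a b (suc n) = trans (cong (a * b *_) (^-distribʳ-* a b n)) (interchange a b (a ^ n) (b ^ n))
    where
    interchange : ∀ a b x y → a * b * (x * y) ≡ a * x * (b * y)
    interchange = solve-∀

  odd⇒≡1+2w : ∀ {u} → ¬ 2 ∣ u → ∃[ w ] u ≡ 1 + w * 2
  odd⇒≡1+2w {u} 2∤u with u ℕ.% 2 | ℕ.m≡m%n+[m/n]*n u 2 | ℕ.m%n<n u 2
  ... | 0           | u≡ | _ = ⊥-elim (2∤u (divides (u ℕ./ 2) u≡))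
  ... | 1           | u≡ | _ = u ℕ./ 2 , u≡
  ... | suc (suc _) | _  | s≤s (s≤s ())

  ∣^ : ∀ p {n} → 0 < n → p ∣ p ^ n
  ∣^ p {suc n} _ = ℕ.m∣m*n (p ^ n)

module _ {p : ℕ} (p-prime : Prime p) where
  open import Data.Nat.Base using (_+_; _*_; _^_)
  open import Data.Nat.Divisibility using (_∣_; divides)
  open import Data.Nat.Tactic.RingSolver using (solve-∀)

  instance
    p≢0 : NonZero p
    p≢0 = prime⇒nonZero p-prime

  p∤1 : ¬ p ∣ 1
  p∤1 p∣1 = ¬prime[1] (subst Prime (ℕ.∣1⇒≡1 p∣1) p-prime)

  p>1 : 1 < p
  p>1 = ℕ.nonTrivial⇒n>1 p {{prime⇒nonTrivial p-prime}}

  ∤⇒coprime : ∀ {u} → ¬ p ∣ u → Coprime u p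
  ∤⇒coprime p∤u (d∣u , d∣p) with prime⇒irreducible p-prime d∣p
  ... | inj₁ d≡1 = d≡1
  ... | inj₂ refl = ⊥-elim (p∤u d∣u)

  ∤⇒coprime-^ : ∀ {u} → ¬ p ∣ u → ∀ D → Coprime u (p ^ D)
  ∤⇒coprime-^ p∤u zero    = Coprime.sym (Coprime.1-coprimeTo _)
  ∤⇒coprime-^ p∤u (suc D) = coprime-* (∤⇒coprime p∤u) (∤⇒coprime-^ p∤u D)

  coprime-^⇒∤ : ∀ {u} D → Coprime u (p ^ suc D) → ¬ p ∣ u
  coprime-^⇒∤ D u⊥p^D p∣u = p∤1 (subst (p ∣_) (u⊥p^D (p∣u , ℕ.m∣m*n (p ^ D))) ℕ.∣-refl)

  ^∣*∤⇒^∣ : ∀ {Q} → ¬ p ∣ Q → ∀ K X → p ^ K ∣ X * Q → p ^ K ∣ X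
  ^∣*∤⇒^∣ {Q} p∤Q K X p^K∣XQ =
    Coprime.coprime-divisor (Coprime.sym (∤⇒coprime-^ p∤Q K)) (subst (p ^ K ∣_) (ℕ.*-comm X Q) p^K∣XQ)

  ^suc∣^*⇒∣ : ∀ K u → p ^ suc K ∣ p ^ K * u → p ∣ u
  ^suc∣^*⇒∣ K u d = ℕ.*-cancelˡ-∣ (p ^ K) {{ℕ.m^n≢0 p K}} (subst (_∣ p ^ K * u) (ℕ.*-comm p (p ^ K)) d)

  p-part : ∀ s → .{{NonZero s}} → ∃[ d ] ∃[ u ] s ≡ p ^ d * u × ¬ p ∣ u
  p-part s = go s (<-wellFounded s)
    where
    go : ∀ s → .{{NonZero s}} → Acc _<_ s → ∃[ d ] ∃[ u ] s ≡ p ^ d * u × ¬ p ∣ u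
    go s (acc rec) with p ℕ.∣? s
    ... | no p∤s = 0 , s , sym (ℕ.*-identityˡ s) , p∤s
    ... | yes (divides q refl) =
      let instance _ = ℕ.m*n≢0⇒m≢0 q
          (d , u , q≡ , p∤u) = go q (rec (ℕ.m<m*n q p p>1))
      in suc d , u , trans (cong (_* p) q≡) (trans (ℕ.*-comm (p ^ d * u) p) (sym (ℕ.*-assoc p (p ^ d) u))) , p∤u

  p-part-mod : ∀ n .{{_ : NonZero n}} a .{{_ : NonZero a}} →
    ∃[ q ] ∃[ ρ ] ∃[ u ] (ρ < n × ¬ p ∣ u × a ≡ (p ^ q) ^ n * (p ^ ρ * u))
  p-part-mod n a =
    let (v , u , a≡ , p∤u) = p-part a
    in v ℕ./ n , v ℕ.% n , u , ℕ.m%n<n v n , p∤u , (begin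
      a                                          ≡⟨ a≡ ⟩
      p ^ v * u                                  ≡⟨ cong (λ e → p ^ e * u) (ℕ.m≡m%n+[m/n]*n v n) ⟩
      p ^ (v ℕ.% n + v ℕ./ n * n) * u            ≡⟨ cong (_* u) (ℕ.^-distribˡ-+-* p (v ℕ.% n) _) ⟩
      p ^ (v ℕ.% n) * p ^ (v ℕ./ n * n) * u      ≡⟨ cong (λ P → p ^ (v ℕ.% n) * P * u) (ℕ.^-*-assoc p (v ℕ./ n) n) ⟨
      p ^ (v ℕ.% n) * (p ^ (v ℕ./ n)) ^ n * u    ≡⟨ rotate (p ^ (v ℕ.% n)) _ u ⟩
      (p ^ (v ℕ./ n)) ^ n * (p ^ (v ℕ.% n) * u)  ∎)
    where
    open ≡-Reasoning
    rotate : ∀ a b c → a * b * c ≡ b * (a * c)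
    rotate = solve-∀

  valuation⇒factor : ∀ {n k} → IsValuation p n k → ∃[ r ] n ≡ p ^ k * r × ¬ p ∣ r
  valuation⇒factor {k = k} (divides r n≡r*p^k , p^1+k∤n) =
    r , trans n≡r*p^k (ℕ.*-comm r (p ^ k)) ,
    λ { (divides r′ refl) → p^1+k∤n (divides r′ (trans n≡r*p^k (ℕ.*-assoc r′ p (p ^ k)))) }

  p^1+C∣p^A*u+p^C*v⇒A≡C : ∀ A C {u v} → ¬ p ∣ u → ¬ p ∣ v → p ^ suc C ∣ p ^ A * u + p ^ C * v → A ≡ C
  p^1+C∣p^A*u+p^C*v⇒A≡C A C {u} {v} p∤u p∤v d with ℕ.<-cmp A C
  ... | tri≈ _ A≡C _ = A≡C
  ... | tri< A<C _ _ = ⊥-elim (p∤u (^suc∣^*⇒∣ A u (ℕ.∣m+n∣m⇒∣n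
          (subst (p ^ suc A ∣_) (ℕ.+-comm (p ^ A * u) _) (ℕ.∣-trans (^-monoʳ-∣ p (s≤s (ℕ.<⇒≤ A<C))) d))
          (ℕ.∣m⇒∣m*n v (^-monoʳ-∣ p A<C)))))
  ... | tri> _ _ C<A = ⊥-elim (p∤v (^suc∣^*⇒∣ C v (ℕ.∣m+n∣m⇒∣n d (ℕ.∣m⇒∣m*n u (^-monoʳ-∣ p C<A)))))

  cross⇒ValAtLeast-ℕ : ∀ N E {num den Q₀ W} → Coprime den num → ¬ p ∣ Q₀ →
    num * (p ^ E * Q₀) ≡ p ^ (N + E) * W * den → p ^ N ∣ num × ¬ p ∣ den
  cross⇒ValAtLeast-ℕ N E {num} {den} {Q₀} {W} den⊥num p∤Q₀ eq =
    ^∣*∤⇒^∣ p∤Q₀ N num (divides (W * den) (trans num*Q₀≡ (move (p ^ N) W den))) ,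
    λ p∣den → p∤Q₀ (ℕ.∣-trans p∣den (Coprime.coprime-divisor den⊥num (divides (p ^ N * W) num*Q₀≡)))
    where
    move : ∀ P W d → P * W * d ≡ W * d * P
    move = solve-∀
    num*Q₀≡ : num * Q₀ ≡ p ^ N * W * den
    num*Q₀≡ = ℕ.*-cancelˡ-≡ (num * Q₀) (p ^ N * W * den) (p ^ E) {{ℕ.m^n≢0 p E}} (begin
      p ^ E * (num * Q₀)       ≡⟨ swap (p ^ E) num Q₀ ⟩
      num * (p ^ E * Q₀)       ≡⟨ eq ⟩
      p ^ (N + E) * W * den    ≡⟨ cong (λ P → P * W * den) (ℕ.^-distribˡ-+-* p N E) ⟩
      p ^ N * p ^ E * W * den  ≡⟨ regroup (p ^ N) (p ^ E) W den ⟩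
      p ^ E * (p ^ N * W * den) ∎)
      where
      open ≡-Reasoning
      swap : ∀ a b c → a * (b * c) ≡ b * (a * c)
      swap = solve-∀
      regroup : ∀ a b c d → a * b * c * d ≡ b * (a * c * d)
      regroup = solve-∀

module _ where
  open import Data.Integer.Base using (_+_; _-_; _*_; _^_; -_)
  open import Data.Integer.Divisibility.Signed using (_∣_; divides)
  open import Data.Integer.Tactic.RingSolver using (solve-∀)

  pos-^ : ∀ a n → + (a ℕ.^ n) ≡ (+ a) ^ n
  pos-^ a zero    = refl
  pos-^ a (suc n) = trans (ℤ.pos-* a (a ℕ.^ n)) (cong (+ a *_) (pos-^ a n))

  pos-^-+ : ∀ p a b → + (p ℕ.^ (a ℕ.+ b)) ≡ + (p ℕ.^ a) * + (p ℕ.^ b)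
  pos-^-+ p a b = trans (cong +_ (ℕ.^-distribˡ-+-* p a b)) (ℤ.pos-* (p ℕ.^ a) (p ℕ.^ b))

  pos∣⇒∣ : ∀ {a i} → + a ∣ i → a ℕ.∣ ℤ.∣ i ∣
  pos∣⇒∣ = ℤ.∣⇒∣ᵤ

  ∣⇒pos∣ : ∀ {a b} → a ℕ.∣ b → + a ∣ + b
  ∣⇒pos∣ = ℤ.∣ᵤ⇒∣

  pos-^∣-weaken : ∀ p {a b x} → a ≤ b → + (p ℕ.^ b) ∣ x → + (p ℕ.^ a) ∣ x
  pos-^∣-weaken p a≤b = ℤ.∣-trans (∣⇒pos∣ (^-monoʳ-∣ p a≤b))

  ∣m-n⇒∣m^k-n^k : ∀ {d a b} → d ∣ a - b → ∀ k → d ∣ a ^ k - b ^ k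
  ∣m-n⇒∣m^k-n^k {d} {a} {b} d∣a-b zero = divides (+ 0) refl
  ∣m-n⇒∣m^k-n^k {d} {a} {b} d∣a-b (suc k) =
    subst (d ∣_) (telescope a b (a ^ k) (b ^ k))
      (ℤ.∣m∣n⇒∣m+n (ℤ.∣n⇒∣m*n a (∣m-n⇒∣m^k-n^k d∣a-b k)) (ℤ.∣m⇒∣m*n (b ^ k) d∣a-b))
    where
    telescope : ∀ a b A B → a * (A - B) + (a - b) * B ≡ a * A - b * B
    telescope = solve-∀

  binomial-mod-h² : ∀ n y h → ∃[ Q ] (y + h) ^ suc n ≡ y ^ suc n + + suc n * y ^ n * h + h * h * Q
  binomial-mod-h² zero y h = + 0 , base y h
    where
    base : ∀ y h → (y + h) * + 1 ≡ y * + 1 + + 1 * + 1 * h + h * h * + 0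
    base = solve-∀
  binomial-mod-h² (suc n) y h =
    let Y = y ^ n; N = + suc n; (Q , eq) = binomial-mod-h² n y h
    in y * Q + N * Y + h * Q , (begin
      (y + h) * (y + h) ^ suc n                                    ≡⟨ cong ((y + h) *_) eq ⟩
      (y + h) * (y * Y + N * Y * h + h * h * Q)                      ≡⟨ step y h Y Q N ⟩
      y * (y * Y) + (+ 1 + N) * (y * Y) * h + h * h * (y * Q + N * Y + h * Q)
        ≡⟨ cong (λ c → y * (y * Y) + c * (y * Y) * h + h * h * (y * Q + N * Y + h * Q)) (ℤ.pos-+ 1 (suc n)) ⟨
      y * (y * Y) + + suc (suc n) * (y * Y) * h + h * h * (y * Q + N * Y + h * Q) ∎)
    where
    open ≡-Reasoning
    step : ∀ y h Y Q N → (y + h) * (y * Y + N * Y * h + h * h * Q)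
                       ≡ y * (y * Y) + (+ 1 + N) * (y * Y) * h + h * h * (y * Q + N * Y + h * Q)
    step = solve-∀

-- Hensel's lemma

module _ {p : ℕ} (p-prime : Prime p) where
  open import Data.Integer.Base using (_+_; _-_; _*_; _^_; -_)
  open import Data.Integer.Divisibility.Signed using (_∣_; divides)
  open import Data.Integer.Tactic.RingSolver using (solve-∀)

  ∤-* : ∀ {a b} → ¬ + p ∣ a → ¬ + p ∣ b → ¬ + p ∣ a * b
  ∤-* {a} {b} p∤a p∤b p∣ab
    with euclidsLemma ℤ.∣ a ∣ ℤ.∣ b ∣ p-prime (subst (p ℕ.∣_) (ℤ.abs-* a b) (pos∣⇒∣ p∣ab))
  ... | inj₁ p∣a = p∤a (ℤ.∣ᵤ⇒∣ p∣a)
  ... | inj₂ p∣b = p∤b (ℤ.∣ᵤ⇒∣ p∣b)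

  ∤-^ : ∀ {a} → ¬ + p ∣ a → ∀ n → ¬ + p ∣ a ^ n
  ∤-^ p∤a zero    p∣1 = p∤1 p-prime (pos∣⇒∣ p∣1)
  ∤-^ p∤a (suc n) = ∤-* p∤a (∤-^ p∤a n)

  inverse-mod-p-ℕ : ∀ {a} → ¬ p ℕ.∣ a → ∃[ s ] + p ∣ s * + a - + 1
  inverse-mod-p-ℕ {a} p∤a with Coprime.coprime-Bézout (∤⇒coprime p-prime p∤a)
  ... | Bézout.+- x y 1+yp≡xa = + x , divides (+ y) (begin
    + x * + a - + 1          ≡⟨ cong (_- + 1) (ℤ.pos-* x a) ⟨
    + (x ℕ.* a) - + 1        ≡⟨ cong (λ z → + z - + 1) 1+yp≡xa ⟨
    + (1 ℕ.+ y ℕ.* p) - + 1  ≡⟨ cong (_- + 1) (trans (ℤ.pos-+ 1 (y ℕ.* p)) (cong (λ z → + 1 + z) (ℤ.pos-* y p))) ⟩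
    + 1 + + y * + p - + 1    ≡⟨ cancel (+ y * + p) ⟩
    + y * + p                ∎)
    where
    open ≡-Reasoning
    cancel : ∀ b → + 1 + b - + 1 ≡ b
    cancel = solve-∀
  ... | Bézout.-+ x y 1+xa≡yp = - + x , divides (- + y) (begin
    - + x * + a - + 1        ≡⟨ negate (+ x) (+ a) ⟩
    - (+ 1 + + x * + a)      ≡⟨ cong (λ z → - (+ 1 + z)) (ℤ.pos-* x a) ⟨
    - (+ 1 + + (x ℕ.* a))    ≡⟨ cong -_ (ℤ.pos-+ 1 (x ℕ.* a)) ⟨
    - + (1 ℕ.+ x ℕ.* a)      ≡⟨ cong (λ z → - + z) 1+xa≡yp ⟩
    - + (y ℕ.* p)            ≡⟨ cong -_ (ℤ.pos-* y p) ⟩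
    - (+ y * + p)            ≡⟨ ℤ.neg-distribˡ-* (+ y) (+ p) ⟩
    - + y * + p              ∎)
    where
    open ≡-Reasoning
    negate : ∀ b c → - b * c - + 1 ≡ - (+ 1 + b * c)
    negate = solve-∀

  inverse-mod-p : ∀ {u} → ¬ + p ∣ u → ∃[ s ] + p ∣ s * u - + 1
  inverse-mod-p {u} p∤u with ℤ.m∣∣m∣ {u} | inverse-mod-p-ℕ (λ p∣∣u∣ → p∤u (ℤ.∣ᵤ⇒∣ p∣∣u∣))
  ... | divides ε ∣u∣≡εu | s , p∣s∣u∣-1 =
    s * ε , subst (λ z → + p ∣ z - + 1) (trans (cong (s *_) ∣u∣≡εu) (sym (ℤ.*-assoc s ε u))) p∣s∣u∣-1

  hensel-step : ∀ k {r n′} → suc n′ ≡ p ℕ.^ k ℕ.* r → ¬ p ℕ.∣ r → ∀ L → k < L → ∀ {A y} → ¬ + p ∣ y →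
                + (p ℕ.^ (k ℕ.+ L)) ∣ A - y ^ suc n′ →
                ∃[ y′ ] (+ (p ℕ.^ suc (k ℕ.+ L)) ∣ A - y′ ^ suc n′ × ¬ + p ∣ y′)
  hensel-step k {r} {n′} n≡p^kr p∤r L k<L {A} {y} p∤y (divides d A-yⁿ≡dp^M) =
    y + h , subst (+ (p ℕ.^ suc (k ℕ.+ L)) ∣_) (sym key) (ℤ.∣m∣n⇒∣m-n p^1+M∣linear p^1+M∣quadratic) , p∤y+h
    where
    PK = + (p ℕ.^ k)
    PL = + (p ℕ.^ L)
    Y  = y ^ n′
    u  = + r * Y
    p∤u : ¬ + p ∣ u
    p∤u = ∤-* {+ r} (λ p∣r → p∤r (pos∣⇒∣ p∣r)) (∤-^ p∤y n′)
    s  = proj₁ (inverse-mod-p p∤u)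
    -- Newton step: n·y^(n-1) = p^k·u and s inverts u modulo p.
    h  = PL * (s * d)
    Q  = proj₁ (binomial-mod-h² n′ y h)

    key : A - (y + h) ^ suc n′ ≡ d * (PK * PL) * (+ 1 - s * u) - PL * PL * (s * d * (s * d) * Q)
    key = begin
      A - (y + h) ^ suc n′                            ≡⟨ cong (λ z → A - z) (proj₂ (binomial-mod-h² n′ y h)) ⟩
      A - (y * Y + + suc n′ * Y * h + h * h * Q)      ≡⟨ regroup A (y * Y) (+ suc n′ * Y * h) (h * h * Q) ⟩
      A - y * Y - + suc n′ * Y * h - h * h * Q
        ≡⟨ cong₂ (λ a b → a - b * Y * h - h * h * Q)
                 (trans A-yⁿ≡dp^M (cong (d *_) (pos-^-+ p k L))) (trans (cong +_ n≡p^kr) (ℤ.pos-* (p ℕ.^ k) r)) ⟩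
      d * (PK * PL) - PK * + r * Y * h - h * h * Q    ≡⟨ collect d PK PL (+ r) Y s Q ⟩
      d * (PK * PL) * (+ 1 - s * u) - PL * PL * (s * d * (s * d) * Q) ∎
      where
      open ≡-Reasoning
      regroup : ∀ a b c e → a - (b + c + e) ≡ a - b - c - e
      regroup = solve-∀
      collect : ∀ d PK PL R Y s Q →
        d * (PK * PL) - PK * R * Y * (PL * (s * d)) - PL * (s * d) * (PL * (s * d)) * Q
          ≡ d * (PK * PL) * (+ 1 - s * (R * Y)) - PL * PL * (s * d * (s * d) * Q)
      collect = solve-∀

    p∣1-su : + p ∣ + 1 - s * u
    p∣1-su = subst (+ p ∣_) (negate s u) (ℤ.∣m⇒∣-m (proj₂ (inverse-mod-p p∤u)))
      where
      negate : ∀ s u → - (s * u - + 1) ≡ + 1 - s * u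
      negate = solve-∀

    p^1+M∣linear : + (p ℕ.^ suc (k ℕ.+ L)) ∣ d * (PK * PL) * (+ 1 - s * u)
    p^1+M∣linear = subst₂ _∣_ p^1+M≡ (sym (ℤ.*-assoc d (PK * PL) _))
                     (ℤ.∣n⇒∣m*n d (ℤ.*-monoʳ-∣ (PK * PL) p∣1-su))
      where
      p^1+M≡ : PK * PL * + p ≡ + (p ℕ.^ suc (k ℕ.+ L))
      p^1+M≡ = trans (cong (_* + p) (sym (pos-^-+ p k L)))
                     (trans (ℤ.*-comm _ (+ p)) (sym (ℤ.pos-* p (p ℕ.^ (k ℕ.+ L)))))

    p^1+M∣quadratic : + (p ℕ.^ suc (k ℕ.+ L)) ∣ PL * PL * (s * d * (s * d) * Q)
    p^1+M∣quadratic = ℤ.∣m⇒∣m*n _ (pos-^∣-weaken p (ℕ.+-monoˡ-≤ L k<L) (ℤ.∣-reflexive (pos-^-+ p L L)))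

    p∤y+h : ¬ + p ∣ y + h
    p∤y+h p∣y+h = p∤y (subst (+ p ∣_) (cancel y h) (ℤ.∣m∣n⇒∣m-n p∣y+h p∣h))
      where
      p∣h : + p ∣ h
      p∣h = ℤ.∣m⇒∣m*n (s * d) (∣⇒pos∣ (∣^ p (ℕ.≤-trans (s≤s z≤n) k<L)))
      cancel : ∀ y h → y + h - h ≡ y
      cancel = solve-∀

  hensel : ∀ k {r n′} → suc n′ ≡ p ℕ.^ k ℕ.* r → ¬ p ℕ.∣ r → ∀ {A y} → ¬ + p ∣ y →
           + (p ℕ.^ (2 ℕ.* k ℕ.+ 1)) ∣ A - y ^ suc n′ →
           ∀ M → ∃[ y′ ] (+ (p ℕ.^ M) ∣ A - y′ ^ suc n′ × ¬ + p ∣ y′)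
  hensel k {r} {n′} n≡p^kr p∤r {A} {y} p∤y p^2k+1∣ M =
    let (y′ , p^N∣ , p∤y′) = lift M
    in y′ , pos-^∣-weaken p (ℕ.≤-trans (ℕ.m≤n+m M (suc k)) (ℕ.m≤n+m _ k)) p^N∣ , p∤y′
    where
    Lifted : ℕ → Set
    Lifted e = ∃[ y′ ] (+ (p ℕ.^ e) ∣ A - y′ ^ suc n′ × ¬ + p ∣ y′)

    lift : ∀ j → Lifted (k ℕ.+ (suc k ℕ.+ j))
    lift zero    = y , subst (λ e → + (p ℕ.^ e) ∣ A - y ^ suc n′) 2k+1≡ p^2k+1∣ , p∤y
      where
      2k+1≡ : 2 ℕ.* k ℕ.+ 1 ≡ k ℕ.+ suc (k ℕ.+ 0)
      2k+1≡ = trans (ℕ.+-comm _ 1) (sym (ℕ.+-suc k (k ℕ.+ 0)))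
    lift (suc j) =
      let (y′ , p^e∣ , p∤y′) = lift j
      in subst Lifted (trans (sym (ℕ.+-suc k _)) (cong (k ℕ.+_) (sym (ℕ.+-suc (suc k) j))))
           (hensel-step k n≡p^kr p∤r (suc k ℕ.+ j) (s≤s (ℕ.m≤m+n k j)) {A} p∤y′ p^e∣)

-- Sums of n-th powers and their p-adic closure

module _ where
  open import Data.Integer.Base using (_+_; _-_; _*_; _^_; -_)
  open import Data.Integer.Divisibility.Signed using (_∣_; divides)
  open import Data.Integer.Tactic.RingSolver using (solve-∀)

  sumℕ-cong : ∀ m {f g : Fin m → ℕ} → (∀ i → f i ≡ g i) → sumℕ m f ≡ sumℕ m g
  sumℕ-cong zero    f≗g = refl
  sumℕ-cong (suc m) f≗g = cong₂ ℕ._+_ (f≗g zero) (sumℕ-cong m (λ i → f≗g (suc i)))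

  sumℤ-cong : ∀ m {f g : Fin m → ℤ} → (∀ i → f i ≡ g i) → sumℤ m f ≡ sumℤ m g
  sumℤ-cong zero    f≗g = refl
  sumℤ-cong (suc m) f≗g = cong₂ _+_ (f≗g zero) (sumℤ-cong m (λ i → f≗g (suc i)))

  pos-sumℕ : ∀ m (f : Fin m → ℕ) → + sumℕ m f ≡ sumℤ m (λ i → + f i)
  pos-sumℕ zero    f = refl
  pos-sumℕ (suc m) f = trans (ℤ.pos-+ (f zero) _) (cong (λ s → + f zero + s) (pos-sumℕ m (λ i → f (suc i))))

  sumℤ-∣-cong : ∀ {d} m (f g : Fin m → ℤ) → (∀ i → d ∣ f i - g i) → d ∣ sumℤ m f - sumℤ m g
  sumℤ-∣-cong zero    f g d∣f-g = divides (+ 0) refl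
  sumℤ-∣-cong {d} (suc m) f g d∣f-g =
    subst (d ∣_) (interchange (f zero) (g zero) _ _)
      (ℤ.∣m∣n⇒∣m+n (d∣f-g zero) (sumℤ-∣-cong m (λ i → f (suc i)) (λ i → g (suc i)) (λ i → d∣f-g (suc i))))
    where
    interchange : ∀ a b c e → (a - b) + (c - e) ≡ (a + c) - (b + e)
    interchange = solve-∀

  sumℕ-scale : ∀ m z n (x : Fin m → ℕ) → sumℕ m (λ i → (z ℕ.* x i) ℕ.^ n) ≡ z ℕ.^ n ℕ.* sumℕ m (λ i → x i ℕ.^ n)
  sumℕ-scale zero    z n x = sym (ℕ.*-zeroʳ (z ℕ.^ n))
  sumℕ-scale (suc m) z n x =
    trans (cong₂ ℕ._+_ (^-distribʳ-* z (x zero) n) (sumℕ-scale m z n (λ i → x (suc i))))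
          (sym (ℕ.*-distribˡ-+ (z ℕ.^ n) _ _))

  sumℤ-updateAt : ∀ {m} (g : ℤ → ℤ) (X : Fin m → ℤ) i y →
    sumℤ m (λ j → g (updateAt X i (const y) j)) ≡ sumℤ m (λ j → g (X j)) - g (X i) + g y
  sumℤ-updateAt {suc m} g X zero y = swap (g y) (g (X zero)) (sumℤ m (λ j → g (X (suc j))))
    where
    swap : ∀ b a s → b + s ≡ a + s - a + b
    swap = solve-∀
  sumℤ-updateAt {suc m} g X (suc i) y =
    trans (cong (λ s → g (X zero) + s) (sumℤ-updateAt g (λ j → X (suc j)) i y)) (reassoc (g (X zero)) _ _ _)
    where
    reassoc : ∀ a s b c → a + (s - b + c) ≡ a + s - b + c
    reassoc = solve-∀

  sumℕ-zeros : ∀ m n → sumℕ m (λ _ → 0 ℕ.^ suc n) ≡ 0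
  sumℕ-zeros zero    n = refl
  sumℕ-zeros (suc m) n = sumℕ-zeros m n

  sumℕ-ones : ∀ m n → sumℕ m (λ _ → 1 ℕ.^ n) ≡ m
  sumℕ-ones zero    n = refl
  sumℕ-ones (suc m) n = cong₂ ℕ._+_ (ℕ.^-zeroˡ n) (sumℕ-ones m n)

  InS-zero : ∀ m n → InS m (suc n) 0
  InS-zero m n = (λ _ → 0) , sym (sumℕ-zeros m n)

  InS-scale : ∀ {m n a} z → InS m n a → InS m n (z ℕ.^ n ℕ.* a)
  InS-scale {m} {n} z (x , a≡Σxⁿ) = (λ i → z ℕ.* x i) , trans (cong (z ℕ.^ n ℕ.*_) a≡Σxⁿ) (sym (sumℕ-scale m z n x))

  InS-mono : ∀ {t m n a} → t ≤ m → InS t (suc n) a → InS m (suc n) a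
  InS-mono {m = m} {n} z≤n       (x , refl) = InS-zero m n
  InS-mono {n = n} (s≤s t≤m) (x , refl) =
    let (y , Σ≡Σ) = InS-mono {n = n} t≤m ((λ i → x (suc i)) , refl)
    in (x zero ∷ y) , cong (x zero ℕ.^ suc n ℕ.+_) Σ≡Σ

  InS-≤ : ∀ {j m n} → j ≤ m → InS m (suc n) j
  InS-≤ {j} {n = n} j≤m = InS-mono {n = n} j≤m ((λ _ → 1) , sym (sumℕ-ones j (suc n)))

InClosure : ℕ → ℕ → ℕ → ℤ → Set
InClosure p m n c = ∀ M → ∃[ a ] (InS m n a × + (p ℕ.^ M) ℤ.∣ c ℤ.- + a)

module _ where
  open import Data.Integer.Base using (_+_; _-_; _*_; _^_; -_)
  open import Data.Integer.Divisibility.Signed using (_∣_; divides)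
  open import Data.Integer.Tactic.RingSolver using (solve-∀)

  InClosure-mono : ∀ {p t m n c} → t ≤ m → InClosure p t (suc n) c → InClosure p m (suc n) c
  InClosure-mono {n = n} t≤m c∈S̄ M = let (a , a∈S , p^M∣c-a) = c∈S̄ M in a , InS-mono {n = n} t≤m a∈S , p^M∣c-a

  InClosure-scale : ∀ {p m n c} z → InClosure p m n c → InClosure p m n (+ (z ℕ.^ n) * c)
  InClosure-scale {p} {m} {n} {c} z c∈S̄ M =
    let (a , a∈S , p^M∣c-a) = c∈S̄ M
    in z ℕ.^ n ℕ.* a , InS-scale {n = n} z a∈S ,
       subst (+ (p ℕ.^ M) ∣_) (trans (distrib (+ (z ℕ.^ n)) c (+ a)) (cong (λ w → + (z ℕ.^ n) * c - w) (sym (ℤ.pos-* (z ℕ.^ n) a))))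
             (ℤ.∣n⇒∣m*n (+ (z ℕ.^ n)) p^M∣c-a)
    where
    distrib : ∀ w c a → w * (c - a) ≡ w * c - w * a
    distrib = solve-∀

  ℤ-solutions⇒InClosure : ∀ {p m n c} .{{_ : NonZero p}} →
    (∀ M → Σ (Fin m → ℤ) λ X → + (p ℕ.^ M) ∣ c - sumℤ m (λ i → X i ^ n)) → InClosure p m n c
  ℤ-solutions⇒InClosure {p} {m} {n} {c} solutions M =
    sumℕ m (λ i → x i ℕ.^ n) , (x , refl) ,
    subst (+ (p ℕ.^ M) ∣_) c-Σxⁿ≡ (ℤ.∣m∣n⇒∣m-n p^M∣c-ΣXⁿ (sumℤ-∣-cong m _ _ (λ i → ∣m-n⇒∣m^k-n^k (x≡X i) n)))
    where
    instance _ = ℕ.m^n≢0 p M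
    X = proj₁ (solutions M)
    p^M∣c-ΣXⁿ = proj₂ (solutions M)

    x : Fin m → ℕ
    x i = X i ℤ.%ℕ p ℕ.^ M

    x≡X : ∀ i → + (p ℕ.^ M) ∣ + x i - X i
    x≡X i = divides (- (X i ℤ./ℕ p ℕ.^ M)) (trans (cong (λ w → + x i - w) (ℤ.a≡a%ℕn+[a/ℕn]*n (X i) (p ℕ.^ M)))
                                                  (cancel (+ x i) (X i ℤ./ℕ p ℕ.^ M) (+ (p ℕ.^ M))))
      where
      cancel : ∀ r q K → r - (r + q * K) ≡ - q * K
      cancel = solve-∀

    c-Σxⁿ≡ : c - sumℤ m (λ i → X i ^ n) - (sumℤ m (λ i → (+ x i) ^ n) - sumℤ m (λ i → X i ^ n))
           ≡ c - + sumℕ m (λ i → x i ℕ.^ n)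
    c-Σxⁿ≡ = trans (cancel c _ _) (cong (λ w → c - w) (sym (trans (pos-sumℕ m _) (sumℤ-cong m (λ i → pos-^ (x i) n)))))
      where
      cancel : ∀ c S T → c - S - (T - S) ≡ c - T
      cancel = solve-∀

  module _ {p : ℕ} (p-prime : Prime p) where
    instance
      _ = prime⇒nonZero p-prime

    hensel⇒InClosure : ∀ k {r n′} → suc n′ ≡ p ℕ.^ k ℕ.* r → ¬ p ℕ.∣ r →
      ∀ {t} (X : Fin t → ℤ) i → ¬ + p ∣ X i → ∀ c →
      + (p ℕ.^ (2 ℕ.* k ℕ.+ 1)) ∣ c - sumℤ t (λ j → X j ^ suc n′) → InClosure p t (suc n′) c
    hensel⇒InClosure k {n′ = n′} n≡p^kr p∤r {t} X i p∤Xi c p^2k+1∣c-ΣXⁿ = ℤ-solutions⇒InClosure {p} {t} {n} {c} λ M →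
      let (y , p^M∣A-yⁿ , _) = hensel p-prime k n≡p^kr p∤r {A} p∤Xi (subst (_ ∣_) (sym (cancel c S (X i ^ n))) p^2k+1∣c-ΣXⁿ) M
      in updateAt X i (const y) ,
         subst (_ ∣_) (trans (regroup c S (X i ^ n) (y ^ n)) (cong (λ w → c - w) (sym (sumℤ-updateAt (_^ n) X i y)))) p^M∣A-yⁿ
      where
      n = suc n′
      S = sumℤ t (λ j → X j ^ n)
      A = c - S + X i ^ n
      cancel : ∀ c S a → c - S + a - a ≡ c - S
      cancel = solve-∀
      regroup : ∀ c S a b → c - S + a - b ≡ c - (S - a + b)
      regroup = solve-∀

-- p-adic approximation of rationals

module _ where
  open import Data.Integer.Base using (_+_; _-_; _*_; _^_; -_)
  open import Data.Integer.Divisibility.Signed using (_∣_; divides)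
  open import Data.Integer.Tactic.RingSolver using (solve-∀)

  ↥-sub-cross : ∀ a B .{{_ : NonZero B}} (x : ℚ) → let q = ℚ._-_ (+ a ℚ./ B) x in
    ℚ.numerator q * + (B ℕ.* ℚ.denominatorℕ x) ≡ (+ a * ℚ.denominator x - ℚ.numerator x * + B) * ℚ.denominator q
  ↥-sub-cross a (suc b′) x@(mkℚ nx dx′ _) with toℚᵘ-q≃
    where
    toℚᵘ-q≃ : ℚ.toℚᵘ (ℚ._-_ (+ a ℚ./ suc b′) x) ℚᵘ.≃ (ℚᵘ.mkℚᵘ (+ a) b′ ℚᵘ.+ ℚᵘ.mkℚᵘ (- nx) dx′)
    toℚᵘ-q≃ = ℚᵘ.≃-trans (ℚ.toℚᵘ-homo-+ (+ a ℚ./ suc b′) (ℚ.- x))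
                         (ℚᵘ.+-cong (ℚ.toℚᵘ-fromℚᵘ (ℚᵘ.mkℚᵘ (+ a) b′)) (ℚ.toℚᵘ-homo‿- x))
  ... | ℚᵘ.*≡* cross = let q = ℚ._-_ (+ a ℚ./ suc b′) x in
    trans (cong (_* + (suc b′ ℕ.* suc dx′)) (sym (ℚ.↥ᵘ-toℚᵘ q)))
          (trans cross (cong₂ _*_ (cong (λ w → + a * + suc dx′ + w) (sym (ℤ.neg-distribˡ-* nx (+ suc b′))))
                                  (ℚ.↧ᵘ-toℚᵘ q)))

  module _ {p : ℕ} (p-prime : Prime p) where
    instance
      _ = prime⇒nonZero p-prime

    cross⇒ValAtLeast : ∀ {q : ℚ} N E {Q₀} (W : ℤ) → ¬ p ℕ.∣ Q₀ →
      ℚ.numerator q * + (p ℕ.^ E ℕ.* Q₀) ≡ + (p ℕ.^ (N ℕ.+ E)) * W * ℚ.denominator q → ValAtLeast p N q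
    cross⇒ValAtLeast {q@(mkℚ num den′ num⊥den)} N E {Q₀} W p∤Q₀ eq =
      cross⇒ValAtLeast-ℕ p-prime N E (Coprime.sym (Coprime.recompute num⊥den)) p∤Q₀ (begin
        ℤ.∣ num ∣ ℕ.* (p ℕ.^ E ℕ.* Q₀)                      ≡⟨ ℤ.abs-* num _ ⟨
        ℤ.∣ num * + (p ℕ.^ E ℕ.* Q₀) ∣                       ≡⟨ cong ℤ.∣_∣ eq ⟩
        ℤ.∣ + (p ℕ.^ (N ℕ.+ E)) * W * + suc den′ ∣           ≡⟨ ℤ.abs-* (+ (p ℕ.^ (N ℕ.+ E)) * W) _ ⟩
        ℤ.∣ + (p ℕ.^ (N ℕ.+ E)) * W ∣ ℕ.* suc den′           ≡⟨ cong (ℕ._* suc den′) (ℤ.abs-* (+ (p ℕ.^ (N ℕ.+ E))) W) ⟩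
        p ℕ.^ (N ℕ.+ E) ℕ.* ℤ.∣ W ∣ ℕ.* suc den′             ∎)
      where open ≡-Reasoning

    ValAtLeast-sub : ∀ x N a B .{{_ : NonZero B}} {E Q₀} → B ℕ.* ℚ.denominatorℕ x ≡ p ℕ.^ E ℕ.* Q₀ → ¬ p ℕ.∣ Q₀ →
      + (p ℕ.^ (N ℕ.+ E)) ∣ + a * ℚ.denominator x - ℚ.numerator x * + B → ValAtLeast p N (ℚ._-_ (+ a ℚ./ B) x)
    ValAtLeast-sub x N a B {E} {Q₀} B↧x≡ p∤Q₀ (divides W eqW) =
      cross⇒ValAtLeast {q} N E W p∤Q₀ (begin
        ℚ.numerator q * + (p ℕ.^ E ℕ.* Q₀)                   ≡⟨ cong (λ z → ℚ.numerator q * + z) B↧x≡ ⟨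
        ℚ.numerator q * + (B ℕ.* ℚ.denominatorℕ x)          ≡⟨ ↥-sub-cross a B x ⟩
        (+ a * ℚ.denominator x - ℚ.numerator x * + B) * ℚ.denominator q
                                                             ≡⟨ cong (_* ℚ.denominator q) eqW ⟩
        W * + (p ℕ.^ (N ℕ.+ E)) * ℚ.denominator q            ≡⟨ cong (_* ℚ.denominator q) (ℤ.*-comm W _) ⟩
        + (p ℕ.^ (N ℕ.+ E)) * W * ℚ.denominator q            ∎)
      where
      open ≡-Reasoning
      q = ℚ._-_ (+ a ℚ./ B) x

    ValAtLeast-sub⇒∣ : ∀ x N a B .{{_ : NonZero B}} E → p ℕ.^ E ℕ.∣ B → ValAtLeast p N (ℚ._-_ (+ a ℚ./ B) x) →
      p ℕ.^ (N ℕ.+ E) ℕ.∣ ℤ.∣ + a * ℚ.denominator x - ℚ.numerator x * + B ∣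
    ValAtLeast-sub⇒∣ x N a B E p^E∣B (p^N∣↥q , p∤↧q) =
      ^∣*∤⇒^∣ p-prime p∤↧q (N ℕ.+ E) _ (subst (p ℕ.^ (N ℕ.+ E) ℕ.∣_) abs-cross
        (subst (ℕ._∣ _) (sym (ℕ.^-distribˡ-+-* p N E)) (ℕ.*-pres-∣ p^N∣↥q (ℕ.∣m⇒∣m*n (ℚ.denominatorℕ x) p^E∣B))))
      where
      q = ℚ._-_ (+ a ℚ./ B) x
      abs-cross : ℤ.∣ ℚ.numerator q ∣ ℕ.* (B ℕ.* ℚ.denominatorℕ x)
                ≡ ℤ.∣ + a * ℚ.denominator x - ℚ.numerator x * + B ∣ ℕ.* ℚ.denominatorℕ q
      abs-cross = trans (sym (ℤ.abs-* (ℚ.numerator q) (+ (B ℕ.* ℚ.denominatorℕ x))))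
                        (trans (cong ℤ.∣_∣ (↥-sub-cross a B x))
                               (ℤ.abs-* (+ a * ℚ.denominator x - ℚ.numerator x * + B) (ℚ.denominator q)))

    Dense⇒a/b≈-X : ∀ {m n} → DenseInQp p m n → ∀ X .{{_ : NonZero X}} N →
      ∃[ a ] ∃[ b ] (InS m n a × InS m n (suc b) × (∀ E → p ℕ.^ E ℕ.∣ suc b → p ℕ.^ (N ℕ.+ E) ℕ.∣ a ℕ.+ X ℕ.* suc b))
    Dense⇒a/b≈-X dense (suc X′) N with dense (mkℚ -[1+ X′ ] 0 (Coprime.sym (Coprime.1-coprimeTo _))) N
    ... | _ , (a , zero , _ , _ , () , _) , _
    ... | _ , (a , suc b , a∈S , b∈S , _ , refl) , val =
      a , b , a∈S , b∈S ,
      λ E p^E∣b → subst (p ℕ.^ (N ℕ.+ E) ℕ.∣_) (cong ℤ.∣_∣ cross) (ValAtLeast-sub⇒∣ (mkℚ -[1+ X′ ] 0 _) N a (suc b) E p^E∣b val)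
      where
      expand : ∀ a X b → a * + 1 - (- X) * b ≡ a + X * b
      expand = solve-∀
      cross : + a * + 1 - -[1+ X′ ] * + suc b ≡ + (a ℕ.+ suc X′ ℕ.* suc b)
      cross = trans (expand (+ a) (+ suc X′) (+ suc b))
                    (trans (cong (λ w → + a + w) (sym (ℤ.pos-* (suc X′) (suc b)))) (sym (ℤ.pos-+ a _)))

-- Density when θ ≤ m

InRatioClosure : ℕ → ℕ → ℕ → ℤ → Set
InRatioClosure p m n X = ∃[ b ] (InS m n b × NonZero b × InClosure p m n (X ℤ.* + b))

module _ {p : ℕ} (p-prime : Prime p) where
  open import Data.Integer.Base using (_+_; _-_; _*_; _^_; -_)
  open import Data.Integer.Divisibility.Signed using (_∣_; divides)
  open import Data.Integer.Tactic.RingSolver using (solve-∀)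

  InRatioClosure⇒Dense : ∀ {m n′} → (∀ X → InRatioClosure p m (suc n′) X) → DenseInQp p m (suc n′)
  -- x = nx/dx is approached by a/(dx^n·b), where a ∈ S approximates nx·dx^(n-1)·b.
  InRatioClosure⇒Dense {m} {n′} ratios x N = approximant (ratios X)
    where
    n  = suc n′
    nx = ℚ.numerator x
    dx = ℚ.denominatorℕ x
    X  = nx * + (dx ℕ.^ n′)

    cross : ∀ b a → - ((X * + b - + a) * + dx) ≡ + a * + dx - nx * + (dx ℕ.^ n ℕ.* b)
    cross b a = trans (rearrange nx (+ (dx ℕ.^ n′)) (+ b) (+ a) (+ dx))
                      (cong (λ w → + a * + dx - nx * w) (sym (trans (ℤ.pos-* (dx ℕ.^ n) b) (cong (_* + b) (ℤ.pos-* dx (dx ℕ.^ n′))))))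
      where
      rearrange : ∀ nx D b a d → - ((nx * D * b - a) * d) ≡ a * d - nx * (d * D * b)
      rearrange = solve-∀

    approximant : InRatioClosure p m n X → Σ ℚ λ r → InR m n r × ValAtLeast p N (ℚ._-_ r x)
    approximant (b , b∈S , b≢0 , Xb∈S̄) =
      let instance _ = b≢0
          B = dx ℕ.^ n ℕ.* b
          instance B≢0 = ℕ.m*n≢0 (dx ℕ.^ n) b {{ℕ.m^n≢0 dx n}}
          instance _ = ℕ.m*n≢0 B dx
          (E , Q₀ , B·dx≡ , p∤Q₀) = p-part p-prime (B ℕ.* dx)
          (a , a∈S , p^∣Xb-a) = Xb∈S̄ (N ℕ.+ E)
      in + a ℚ./ B , (a , B , a∈S , InS-scale {n = n} dx b∈S , B≢0 , refl) ,
         ValAtLeast-sub p-prime x N a B B·dx≡ p∤Q₀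
           (subst (_ ∣_) (cross b a) (ℤ.∣m⇒∣-m (ℤ.∣m⇒∣m*n (+ dx) p^∣Xb-a)))

  θ≤m⇒Dense : ∀ {m n k t} → 2 ≤ n → IsValuation p n k → IsTheta n (p ℕ.^ (2 ℕ.* k ℕ.+ 1)) t → t ≤ m →
              DenseInQp p m n
  θ≤m⇒Dense {m} {suc n′} {k} {t} _ val (1≤t , (Xθ , p^D∣ΣXθⁿ , i , Xθi⊥p^D) , _) t≤m
    with valuation⇒factor p-prime {k = k} val
  ... | r , n≡p^kr , p∤r = InRatioClosure⇒Dense {m} {n′} λ X →
      b , InS-scale {m} {n} (p ℕ.^ D) (InS-≤ {n = n′} (ℕ.≤-trans 1≤t t≤m)) , ℕ.m*n≢0 _ 1 {{ℕ.m^n≢0 _ n {{ℕ.m^n≢0 p D}}}} ,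
      InClosure-mono {p} {t} {m} {n′} {X * + b} t≤m (hensel⇒InClosure p-prime k {r} n≡p^kr p∤r Xθ i p∤Xθi (X * + b)
        (ℤ.∣m∣n⇒∣m-n (ℤ.∣n⇒∣m*n X (∣⇒pos∣ (ℕ.∣m⇒∣m*n 1 (ℕ.m∣m*n _)))) (ℤ.∣ᵤ⇒∣ p^D∣ΣXθⁿ)))
    where
    instance _ = prime⇒nonZero p-prime
    n = suc n′
    D = 2 ℕ.* k ℕ.+ 1
    b = (p ℕ.^ D) ℕ.^ n ℕ.* 1
    p∤Xθi : ¬ + p ∣ Xθ i
    p∤Xθi p∣Xθi = coprime-^⇒∤ p-prime (2 ℕ.* k) (subst (λ e → Coprime ℤ.∣ Xθ i ∣ (p ℕ.^ e)) (ℕ.+-comm (2 ℕ.* k) 1) Xθi⊥p^D)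
                               (pos∣⇒∣ p∣Xθi)

-- Non-density

module _ where
  open import Data.Nat.Base using (_+_; _*_)
  open import Data.Nat.Tactic.RingSolver using (solve-∀)

  n*e+d≢D+[n*e′+d′] : ∀ n D e e′ d d′ → 2 * D ≤ n → d < D → d′ < D → n * e + d ≢ D + (n * e′ + d′)
  n*e+d≢D+[n*e′+d′] n D e e′ d d′ 2D≤n d<D d′<D eq with e′ ℕ.<? e
  ... | no e′≮e = ℕ.<-irrefl eq (begin-strict
      n * e + d           <⟨ ℕ.+-mono-≤-< (ℕ.*-monoʳ-≤ n (ℕ.≮⇒≥ e′≮e)) d<D ⟩
      n * e′ + D          ≡⟨ ℕ.+-comm (n * e′) D ⟩
      D + n * e′          ≤⟨ ℕ.m≤m+n (D + n * e′) d′ ⟩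
      D + n * e′ + d′     ≡⟨ ℕ.+-assoc D (n * e′) d′ ⟩
      D + (n * e′ + d′)   ∎)
    where open ℕ.≤-Reasoning
  ... | yes e′<e = ℕ.<-irrefl (sym eq) (begin-strict
      D + (n * e′ + d′)   <⟨ ℕ.+-monoʳ-< D (ℕ.+-monoʳ-< (n * e′) d′<D) ⟩
      D + (n * e′ + D)    ≡⟨ regroup D (n * e′) ⟩
      n * e′ + 2 * D      ≤⟨ ℕ.+-monoʳ-≤ (n * e′) 2D≤n ⟩
      n * e′ + n          ≡⟨ ℕ.+-comm (n * e′) n ⟩
      n + n * e′          ≡⟨ ℕ.*-suc n e′ ⟨
      n * suc e′          ≤⟨ ℕ.*-monoʳ-≤ n e′<e ⟩
      n * e               ≤⟨ ℕ.m≤m+n (n * e) d ⟩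
      n * e + d           ∎)
    where
    open ℕ.≤-Reasoning
    regroup : ∀ D x → D + (x + D) ≡ x + 2 * D
    regroup = solve-∀

UnitPowerSum : ℕ → ℕ → ℕ → ℕ → Set
UnitPowerSum p m n w = Σ (Fin m → ℕ) λ y → w ≡ sumℕ m (λ i → y i ℕ.^ n) × ∃[ i ] ¬ p ℕ.∣ y i

module _ {p : ℕ} (p-prime : Prime p) where
  open import Data.Nat.Base using (_+_; _*_; _^_; _∸_)
  open import Data.Nat.Divisibility using (_∣_; _∣?_; divides)
  open import Data.Nat.Tactic.RingSolver using (solve-∀)

  instance
    _ = prime⇒nonZero p-prime

  InS⇒p^ne*UnitPowerSum : ∀ {m n} s → .{{NonZero s}} → InS m (suc n) s →
    ∃[ e ] ∃[ w ] (s ≡ p ^ (suc n * e) * w × UnitPowerSum p m (suc n) w)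
  InS⇒p^ne*UnitPowerSum {m} {n′} s s∈S = go s (<-wellFounded s) s∈S
    where
    n = suc n′
    go : ∀ s → .{{NonZero s}} → Acc _<_ s → InS m n s → ∃[ e ] ∃[ w ] (s ≡ p ^ (n * e) * w × UnitPowerSum p m n w)
    go s (acc rec) (x , s≡Σxⁿ) with all? (λ i → p ∣? x i)
    ... | no ¬p∣all =
      0 , s , sym (trans (cong (λ e → p ^ e * s) (ℕ.*-zeroʳ n)) (ℕ.*-identityˡ s)) ,
      x , s≡Σxⁿ , ¬∀⟶∃¬ m _ (λ i → p ∣? x i) ¬p∣all
    ... | yes p∣all =
      let q i = ℕ.quotient (p∣all i)
          s≡pⁿs′ = trans s≡Σxⁿ (trans (sumℕ-cong m (λ i → cong (_^ n) (trans (ℕ.m∣n⇒n≡quotient*m (p∣all i)) (ℕ.*-comm (q i) p))))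
                                      (sumℕ-scale m p n q))
          s′ = sumℕ m (λ i → q i ^ n)
          instance _ = ℕ.m*n≢0⇒n≢0 (p ^ n) {{subst NonZero s≡pⁿs′ it}}
          s′<s = subst (s′ <_) (trans (ℕ.*-comm s′ (p ^ n)) (sym s≡pⁿs′))
                       (ℕ.m<m*n s′ (p ^ n) (ℕ.≤-trans (p>1 p-prime) (ℕ.m≤m*n p (p ^ n′) {{ℕ.m^n≢0 p n′}})))
          (e , w , s′≡ , w∈U) = go s′ (rec s′<s) (q , refl)
      in suc e , w , trans s≡pⁿs′ (trans (cong (p ^ n *_) s′≡) (p^n*p^ne≡ e w)) , w∈U
      where
      p^n*p^ne≡ : ∀ e w → p ^ n * (p ^ (n * e) * w) ≡ p ^ (n * suc e) * w
      p^n*p^ne≡ e w = trans (sym (ℕ.*-assoc (p ^ n) _ w))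
                            (cong (_* w) (trans (sym (ℕ.^-distribˡ-+-* p n (n * e))) (cong (p ^_) (sym (ℕ.*-suc n e)))))

  ^+∣^*⇒^∣ : ∀ N E X → p ^ (N + E) ∣ p ^ E * X → p ^ N ∣ X
  ^+∣^*⇒^∣ N E X d = ℕ.*-cancelˡ-∣ (p ^ E) {{ℕ.m^n≢0 p E}}
    (subst (_∣ p ^ E * X) (trans (cong (p ^_) (ℕ.+-comm N E)) (ℕ.^-distribˡ-+-* p E N)) d)

  InS⇒p^[ne+d]*u : ∀ {m n} D → (∀ w → UnitPowerSum p m (suc n) w → ¬ p ^ D ∣ w) →
    ∀ s → .{{NonZero s}} → InS m (suc n) s → ∃[ e ] ∃[ d ] ∃[ u ] (s ≡ p ^ (suc n * e + d) * u × d < D × ¬ p ∣ u)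
  InS⇒p^[ne+d]*u {m} {n′} D no-p^D∣ s s∈S =
    let (e , w , s≡ , w∈U) = InS⇒p^ne*UnitPowerSum {m} {n′} s s∈S
        instance _ = ℕ.m*n≢0⇒n≢0 (p ^ (suc n′ * e)) {{subst NonZero s≡ it}}
        (d , u , w≡ , p∤u) = p-part p-prime w
    in e , d , u ,
       trans s≡ (trans (cong (p ^ (suc n′ * e) *_) w≡)
                       (trans (sym (ℕ.*-assoc (p ^ (suc n′ * e)) (p ^ d) u)) (cong (_* u) (sym (ℕ.^-distribˡ-+-* p (suc n′ * e) d))))) ,
       ℕ.≰⇒> (λ D≤d → no-p^D∣ w w∈U (subst (p ^ D ∣_) (sym w≡) (ℕ.∣m⇒∣m*n u (^-monoʳ-∣ p D≤d)))) ,
       p∤u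

  2D≤n⇒¬Dense : ∀ {m n′} D → 2 * D ≤ suc n′ → (∀ w → UnitPowerSum p m (suc n′) w → ¬ p ^ D ∣ w) →
    ¬ DenseInQp p m (suc n′)
  -- An approximation a/b of -p^D forces ν(a) = D + ν(b), impossible for valuations n·e + d, d < D.
  2D≤n⇒¬Dense {m} {n′} D 2D≤n no-p^D∣ dense =
    let instance _ = ℕ.m^n≢0 p D
        (a , b , a∈S , b∈S , a/b≈-p^D) = Dense⇒a/b≈-X p-prime {m} {n} dense (p ^ D) (suc D)
        (e , d , u , b≡ , d<D , p∤u) = InS⇒p^[ne+d]*u {m} {n′} D no-p^D∣ (suc b) b∈S
    in valuations-differ a a∈S {e} d<D p∤u
         (subst (λ z → p ^ suc (D + (n * e + d)) ∣ a + z) (p^D*b≡ b≡)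
                (a/b≈-p^D (n * e + d) (divides u (trans b≡ (ℕ.*-comm (p ^ (n * e + d)) u)))))
    where
    n = suc n′
    p^D*b≡ : ∀ {b B u} → b ≡ p ^ B * u → p ^ D * b ≡ p ^ (D + B) * u
    p^D*b≡ {b} {B} {u} b≡ = trans (cong (p ^ D *_) b≡) (trans (sym (ℕ.*-assoc (p ^ D) (p ^ B) u)) (cong (_* u) (sym (ℕ.^-distribˡ-+-* p D B))))

    valuations-differ : ∀ a → InS m n a → ∀ {e d u} → d < D → ¬ p ∣ u → ¬ p ^ suc (D + (n * e + d)) ∣ a + p ^ (D + (n * e + d)) * u
    valuations-differ zero    _   {e} {d} {u} _ p∤u p^C+1∣ = p∤u (^suc∣^*⇒∣ p-prime (D + (n * e + d)) u p^C+1∣)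
    valuations-differ (suc a) a∈S {e} {d} {u} d<D p∤u p^C+1∣ =
      let (e₁ , d₁ , u₁ , a≡ , d₁<D , p∤u₁) = InS⇒p^[ne+d]*u {m} {n′} D no-p^D∣ (suc a) a∈S
      in n*e+d≢D+[n*e′+d′] n D e₁ e d₁ d 2D≤n d₁<D d<D
           (p^1+C∣p^A*u+p^C*v⇒A≡C p-prime (n * e₁ + d₁) (D + (n * e + d)) p∤u₁ p∤u
              (subst (λ z → p ^ suc (D + (n * e + d)) ∣ z + p ^ (D + (n * e + d)) * u) a≡ p^C+1∣))

  p^ne*w+p^ne′*w′≡ : ∀ n {e e′} → e < e′ → ∀ w w′ →
    p ^ (n * e) * w + p ^ (n * e′) * w′ ≡ p ^ (n * e) * (w + p ^ n * (p ^ (n * (e′ ∸ suc e)) * w′))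
  p^ne*w+p^ne′*w′≡ n {e} {e′} e<e′ w w′ = begin
    p ^ (n * e) * w + p ^ (n * e′) * w′                       ≡⟨ cong (λ z → p ^ (n * e) * w + p ^ (n * z) * w′) e′≡ ⟩
    p ^ (n * e) * w + p ^ (n * (e + suc c)) * w′              ≡⟨ cong (λ z → p ^ (n * e) * w + z * w′) p^[n[e+1+c]]≡ ⟩
    p ^ (n * e) * w + p ^ (n * e) * (p ^ n * p ^ (n * c)) * w′ ≡⟨ factor (p ^ (n * e)) (p ^ n) (p ^ (n * c)) w w′ ⟩
    p ^ (n * e) * (w + p ^ n * (p ^ (n * c) * w′))            ∎
    where
    open ≡-Reasoning
    c = e′ ∸ suc e
    e′≡ : e′ ≡ e + suc c
    e′≡ = trans (sym (ℕ.m+[n∸m]≡n e<e′)) (sym (ℕ.+-suc e c))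
    p^[n[e+1+c]]≡ : p ^ (n * (e + suc c)) ≡ p ^ (n * e) * (p ^ n * p ^ (n * c))
    p^[n[e+1+c]]≡ = trans (cong (p ^_) (trans (ℕ.*-distribˡ-+ n e (suc c)) (cong (_+_ (n * e)) (ℕ.*-suc n c))))
                          (trans (ℕ.^-distribˡ-+-* p (n * e) _) (cong (p ^ (n * e) *_) (ℕ.^-distribˡ-+-* p n (n * c))))
    factor : ∀ P Q R w w′ → P * w + P * (Q * R) * w′ ≡ P * (w + Q * (R * w′))
    factor = solve-∀

  -- For an approximation a/b of -1 write a = p^(ne)·w, b = p^(ne′)·w′: the two hypotheses cover
  -- e ≠ e′, where a + b = p^(n·min)·(w + p^n·t), and e = e′.
  no-cancellation⇒¬Dense : ∀ {m n′} N →
    (∀ w t → UnitPowerSum p m (suc n′) w → ¬ p ^ N ∣ w + p ^ suc n′ * t) →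
    (∀ w w′ → UnitPowerSum p m (suc n′) w → UnitPowerSum p m (suc n′) w′ → ¬ p ^ N ∣ w + w′) →
    ¬ DenseInQp p m (suc n′)
  no-cancellation⇒¬Dense {m} {n′} N no-p^N∣w+pⁿt no-p^N∣w+w′ dense =
    let (a , b , a∈S , b∈S , a/b≈-1) = Dense⇒a/b≈-X p-prime {m} {n} dense 1 N
        (e , w , b≡ , w∈U) = InS⇒p^ne*UnitPowerSum {m} {n′} (suc b) b∈S
    in no-cancellation a a∈S w∈U
         (subst (λ z → p ^ (N + n * e) ∣ a + z) (trans (ℕ.*-identityˡ (suc b)) b≡)
                (a/b≈-1 (n * e) (divides w (trans b≡ (ℕ.*-comm (p ^ (n * e)) w)))))
    where
    n = suc n′
    no-cancellation : ∀ a → InS m n a → ∀ {e w} → UnitPowerSum p m n w → ¬ p ^ (N + n * e) ∣ a + p ^ (n * e) * w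
    no-cancellation zero _ {e} {w} w∈U p^∣ =
      no-p^N∣w+pⁿt w 0 w∈U (subst (p ^ N ∣_) (sym (trans (cong (_+_ w) (ℕ.*-zeroʳ (p ^ n))) (ℕ.+-identityʳ w)))
                                 (^+∣^*⇒^∣ N (n * e) w p^∣))
    no-cancellation (suc a) a∈S {e} {w} w∈U p^∣ with InS⇒p^ne*UnitPowerSum {m} {n′} (suc a) a∈S
    ... | e₁ , w₁ , a≡ , w₁∈U with ℕ.<-cmp e₁ e
    ...   | tri≈ _ refl _ = no-p^N∣w+w′ w₁ w w₁∈U w∈U
            (^+∣^*⇒^∣ N (n * e) (w₁ + w)
              (subst (p ^ (N + n * e) ∣_) (trans (cong (_+ p ^ (n * e) * w) a≡) (sym (ℕ.*-distribˡ-+ (p ^ (n * e)) w₁ w))) p^∣))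
    ...   | tri< e₁<e _ _ = no-p^N∣w+pⁿt w₁ _ w₁∈U
            (^+∣^*⇒^∣ N (n * e₁) _ (subst (p ^ (N + n * e₁) ∣_) (trans (cong (_+ p ^ (n * e) * w) a≡) (p^ne*w+p^ne′*w′≡ n e₁<e w₁ w))
              (ℕ.∣-trans (^-monoʳ-∣ p (ℕ.+-monoʳ-≤ N (ℕ.*-monoʳ-≤ n (ℕ.<⇒≤ e₁<e)))) p^∣)))
    ...   | tri> _ _ e<e₁ = no-p^N∣w+pⁿt w _ w∈U
            (^+∣^*⇒^∣ N (n * e) _ (subst (p ^ (N + n * e) ∣_)
              (trans (cong (_+ p ^ (n * e) * w) a≡) (trans (ℕ.+-comm (p ^ (n * e₁) * w₁) _) (p^ne*w+p^ne′*w′≡ n e<e₁ w w₁))) p^∣))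

module _ where
  open import Data.Integer.Base using (_+_; _-_; _*_; _^_; -_)
  open import Data.Integer.Tactic.RingSolver using (solve-∀)

  [-1]^odd : ∀ n → ¬ 2 ℕ.∣ n → (- + 1) ^ n ≡ - + 1
  [-1]^odd zero          2∤0   = ⊥-elim (2∤0 (2 ℕ.∣0))
  [-1]^odd (suc zero)    _     = refl
  [-1]^odd (suc (suc n)) 2∤2+n =
    trans (cancel ((- + 1) ^ n)) ([-1]^odd n (λ 2∣n → 2∤2+n (ℕ.∣m∣n⇒∣m+n ℕ.∣-refl 2∣n)))
    where
    cancel : ∀ x → (- + 1) * ((- + 1) * x) ≡ x
    cancel = solve-∀

  odd⇒Solvable-2 : ∀ {n} → ¬ 2 ℕ.∣ n → ∀ b → Solvable n b 2
  odd⇒Solvable-2 {n} 2∤n b =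
    (+ 1 ∷ const (- + 1)) ,
    subst (λ s → b ℕ.∣ ℤ.∣ s ∣) (sym (cong₂ (λ x y → x + (y + + 0)) (ℤ.^-zeroˡ n) ([-1]^odd n 2∤n))) (b ℕ.∣0) ,
    zero , Coprime.1-coprimeTo b

  UnitPowerSum⇒Solvable : ∀ {p m n w} → Prime p → ∀ D → UnitPowerSum p m n w → p ℕ.^ D ℕ.∣ w → Solvable n (p ℕ.^ D) m
  UnitPowerSum⇒Solvable {p} {m} {n} {w} p-prime D (y , w≡ , i , p∤yi) p^D∣w =
    (λ j → + y j) , subst (λ s → p ℕ.^ D ℕ.∣ ℤ.∣ s ∣) Σ≡w p^D∣w , i , ∤⇒coprime-^ p-prime p∤yi D
    where
    Σ≡w : + w ≡ sumℤ m (λ j → (+ y j) ^ n)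
    Σ≡w = trans (cong +_ w≡) (trans (pos-sumℕ m _) (sumℤ-cong m (λ j → pos-^ (y j) n)))

Exceptional : ℕ → ℕ → Set
Exceptional p n = p ≡ 2 × (n ≡ 2 ⊎ n ≡ 4 ⊎ n ≡ 8 ⊎ n ≡ 16)

module _ where
  open import Data.Nat.Base using (_+_; _*_; _^_)
  open import Data.Nat.Divisibility using (_∣_; _∣?_; divides)
  open import Data.Nat.Tactic.RingSolver using (solve-∀)
  open ℕ.≤-Reasoning

  prime∣^⇒∣ : ∀ {q p} → Prime q → ∀ k → q ∣ p ^ k → q ∣ p
  prime∣^⇒∣ q-prime zero    q∣1   = ⊥-elim (p∤1 q-prime q∣1)
  prime∣^⇒∣ {p = p} q-prime (suc k) q∣p^k with euclidsLemma p (p ^ k) q-prime q∣p^k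
  ... | inj₁ q∣p   = q∣p
  ... | inj₂ q∣p^k = prime∣^⇒∣ q-prime k q∣p^k

  2k+1≤3^k : ∀ k → 2 * k + 1 ≤ 3 ^ k
  2k+1≤3^k zero    = s≤s z≤n
  2k+1≤3^k (suc k) = begin
    2 * suc k + 1              ≤⟨ ℕ.m≤m+n _ (4 * k) ⟩
    2 * suc k + 1 + 4 * k      ≡⟨ expand k ⟩
    3 * (2 * k + 1)            ≤⟨ ℕ.*-monoʳ-≤ 3 (2k+1≤3^k k) ⟩
    3 ^ suc k                  ∎
    where
    expand : ∀ k → 2 * suc k + 1 + 4 * k ≡ 3 * (2 * k + 1)
    expand = solve-∀

  2[2k+1]≤3*2^k : ∀ k → 2 * (2 * suc k + 1) ≤ 3 * 2 ^ suc k
  2[2k+1]≤3*2^k zero    = ℕ.≤-refl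
  2[2k+1]≤3*2^k (suc k) = begin
    2 * (2 * suc (suc k) + 1)                  ≤⟨ ℕ.m≤m+n _ (4 * k + 2) ⟩
    2 * (2 * suc (suc k) + 1) + (4 * k + 2)    ≡⟨ expand k ⟩
    2 * (2 * (2 * suc k + 1))                  ≤⟨ ℕ.*-monoʳ-≤ 2 (2[2k+1]≤3*2^k k) ⟩
    2 * (3 * 2 ^ suc k)                        ≡⟨ swap (2 ^ suc k) ⟩
    3 * 2 ^ suc (suc k)                        ∎
    where
    swap : ∀ x → 2 * (3 * x) ≡ 3 * (2 * x)
    swap = solve-∀
    expand : ∀ k → 2 * (2 * suc (suc k) + 1) + (4 * k + 2) ≡ 2 * (2 * (2 * suc k + 1))
    expand = solve-∀

  2[2k+1]≤2^k : ∀ k → 2 * (2 * (5 + k) + 1) ≤ 2 ^ (5 + k)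
  2[2k+1]≤2^k zero    = ℕ.+-monoʳ-≤ 22 z≤n
  2[2k+1]≤2^k (suc k) = begin
    2 * (2 * (5 + suc k) + 1)                  ≤⟨ ℕ.m≤m+n _ (4 * k + 18) ⟩
    2 * (2 * (5 + suc k) + 1) + (4 * k + 18)   ≡⟨ expand k ⟩
    2 * (2 * (2 * (5 + k) + 1))                ≤⟨ ℕ.*-monoʳ-≤ 2 (2[2k+1]≤2^k k) ⟩
    2 ^ (5 + suc k)                            ∎
    where
    expand : ∀ k → 2 * (2 * (5 + suc k) + 1) + (4 * k + 18) ≡ 2 * (2 * (2 * (5 + k) + 1))
    expand = solve-∀

  2[2k+1]≤2^k*r : ∀ k r → ¬ 2 ∣ r → 2 ∣ 2 ^ k * r → 2 ≤ 2 ^ k * r → ¬ Exceptional 2 (2 ^ k * r) →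
                  2 * (2 * k + 1) ≤ 2 ^ k * r
  2[2k+1]≤2^k*r k zero        2∤r _ _ _ = ⊥-elim (2∤r (2 ℕ.∣0))
  2[2k+1]≤2^k*r k 2           2∤r _ _ _ = ⊥-elim (2∤r ℕ.∣-refl)
  2[2k+1]≤2^k*r 0 1           _ _ (s≤s ()) _
  2[2k+1]≤2^k*r 1 1           _ _ _ not-exc = ⊥-elim (not-exc (refl , inj₁ refl))
  2[2k+1]≤2^k*r 2 1           _ _ _ not-exc = ⊥-elim (not-exc (refl , inj₂ (inj₁ refl)))
  2[2k+1]≤2^k*r 3 1           _ _ _ not-exc = ⊥-elim (not-exc (refl , inj₂ (inj₂ (inj₁ refl))))
  2[2k+1]≤2^k*r 4 1           _ _ _ not-exc = ⊥-elim (not-exc (refl , inj₂ (inj₂ (inj₂ refl))))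
  2[2k+1]≤2^k*r (suc (suc (suc (suc (suc k))))) 1 _ _ _ _ =
    subst (2 * (2 * (5 + k) + 1) ≤_) (sym (ℕ.*-identityʳ (2 ^ (5 + k)))) (2[2k+1]≤2^k k)
  2[2k+1]≤2^k*r zero    r@(suc (suc (suc _))) 2∤r 2∣r _ _ = ⊥-elim (2∤r (subst (2 ∣_) (ℕ.*-identityˡ r) 2∣r))
  2[2k+1]≤2^k*r (suc k) r@(suc (suc (suc _))) _ _ _ _ = begin
    2 * (2 * suc k + 1)   ≤⟨ 2[2k+1]≤3*2^k k ⟩
    3 * 2 ^ suc k         ≡⟨ ℕ.*-comm 3 (2 ^ suc k) ⟩
    2 ^ suc k * 3         ≤⟨ ℕ.*-monoʳ-≤ (2 ^ suc k) (s≤s (s≤s (s≤s z≤n))) ⟩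
    2 ^ suc k * r         ∎

  2[2k+1]≤p^k*r : ∀ {p} k r → 3 ≤ p → 2 ≤ r → 2 * (2 * k + 1) ≤ p ^ k * r
  2[2k+1]≤p^k*r {p} k r 3≤p 2≤r = begin
    2 * (2 * k + 1)   ≤⟨ ℕ.*-monoʳ-≤ 2 (2k+1≤3^k k) ⟩
    2 * 3 ^ k         ≤⟨ ℕ.*-monoʳ-≤ 2 (ℕ.^-monoˡ-≤ k 3≤p) ⟩
    2 * p ^ k         ≡⟨ ℕ.*-comm 2 (p ^ k) ⟩
    p ^ k * 2         ≤⟨ ℕ.*-monoʳ-≤ (p ^ k) 2≤r ⟩
    p ^ k * r         ∎

  module _ {p : ℕ} (p-prime : Prime p) where

    2[2k+1]≤n : ∀ {n k} → IsValuation p n k → 2 ∣ n → 2 ≤ n → ¬ Exceptional p n → 2 * (2 * k + 1) ≤ n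
    2[2k+1]≤n {n} {k} val 2∣n 2≤n not-exc with valuation⇒factor p-prime {k = k} val | p ℕ.≟ 2
    ... | r , refl , p∤r | yes refl = 2[2k+1]≤2^k*r k r p∤r 2∣n 2≤n not-exc
    ... | r , refl , p∤r | no p≢2   = 2[2k+1]≤p^k*r k r 3≤p (2≤r r 2≤n 2∣r)
      where
      3≤p : 3 ≤ p
      3≤p = ℕ.≤∧≢⇒< (p>1 p-prime) (p≢2 ∘ sym)
      2∣r : 2 ∣ r
      2∣r with euclidsLemma (p ^ k) r prime[2] 2∣n
      ... | inj₂ 2∣r   = 2∣r
      ... | inj₁ 2∣p^k with prime⇒irreducible p-prime (prime∣^⇒∣ prime[2] k 2∣p^k)
      ...   | inj₁ ()
      ...   | inj₂ 2≡p = ⊥-elim (p≢2 (sym 2≡p))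
      2≤r : ∀ r → 2 ≤ p ^ k * r → 2 ∣ r → 2 ≤ r
      2≤r zero          2≤0 _   with () ← subst (2 ≤_) (ℕ.*-zeroʳ (p ^ k)) 2≤0
      2≤r (suc zero)    _   2∣1 = ⊥-elim (p∤1 prime[2] 2∣1)
      2≤r (suc (suc _)) _   _   = s≤s (s≤s z≤n)

    m<θ⇒¬Dense : ∀ {m n k t} → 2 ≤ m → 2 ≤ n → IsValuation p n k → IsTheta n (p ^ (2 * k + 1)) t → m < t →
                 ¬ Exceptional p n → ¬ DenseInQp p m n
    m<θ⇒¬Dense {m} {n@(suc n′)} {k} 2≤m 2≤n val (_ , _ , θ-least) m<t not-exc dense with 2 ∣? n
    ... | no 2∤n  = θ-least 2 (s≤s z≤n) (ℕ.≤-<-trans 2≤m m<t) (odd⇒Solvable-2 2∤n _)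
    ... | yes 2∣n = 2D≤n⇒¬Dense p-prime (2 * k + 1) (2[2k+1]≤n {n} {k} val 2∣n 2≤n not-exc) no-unit-sum dense
      where
      no-unit-sum : ∀ w → UnitPowerSum p m n w → ¬ p ^ (2 * k + 1) ∣ w
      no-unit-sum w w∈U p^D∣w = θ-least m (ℕ.≤-trans (s≤s z≤n) 2≤m) m<t (UnitPowerSum⇒Solvable {p} {m} {n} p-prime (2 * k + 1) w∈U p^D∣w)

-- p = 2: density

InRatioClosure± : ℕ → ℕ → ℕ → ℕ → Set
InRatioClosure± p m n x = InRatioClosure p m n (+ x) × InRatioClosure p m n (ℤ.- + x)

module _ {p : ℕ} (p-prime : Prime p) where
  open import Data.Integer.Base using (_+_; _-_; _*_; _^_; -_)
  open import Data.Integer.Divisibility.Signed using (_∣_; divides)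

  InRatioClosure-scale : ∀ {m n X} z → InRatioClosure p m n X → InRatioClosure p m n (+ (z ℕ.^ n) * X)
  InRatioClosure-scale {m} {n} {X} z (b , b∈S , b≢0 , Xb∈S̄) =
    b , b∈S , b≢0 , subst (InClosure p m n) (sym (ℤ.*-assoc (+ (z ℕ.^ n)) X (+ b))) (InClosure-scale {p} {m} {n} z Xb∈S̄)

  InRatioClosure-reduction : ∀ {m n′} → 1 ≤ m →
    (∀ ρ u → ρ < suc n′ → ¬ p ℕ.∣ u → InRatioClosure± p m (suc n′) (p ℕ.^ ρ ℕ.* u)) → ∀ X → InRatioClosure p m (suc n′) X
  InRatioClosure-reduction {m} {n′} 1≤m units (+ zero) =
    1 , InS-≤ {n = n′} 1≤m , _ , λ M → 0 , InS-zero m n′ , divides (+ 0) refl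
  InRatioClosure-reduction {m} {n′} 1≤m units (+ suc a) =
    let (q , ρ , u , ρ<n , p∤u , a≡) = p-part-mod p-prime (suc n′) (suc a)
    in subst (λ z → InRatioClosure p m (suc n′) (+ z)) (sym a≡)
         (subst (InRatioClosure p m (suc n′)) (sym (ℤ.pos-* ((p ℕ.^ q) ℕ.^ suc n′) (p ℕ.^ ρ ℕ.* u)))
                (InRatioClosure-scale {m} {suc n′} (p ℕ.^ q) (proj₁ (units ρ u ρ<n p∤u))))
  InRatioClosure-reduction {m} {n′} 1≤m units -[1+ a ] =
    let (q , ρ , u , ρ<n , p∤u , a≡) = p-part-mod p-prime (suc n′) (suc a)
    in subst (λ z → InRatioClosure p m (suc n′) (- + z)) (sym a≡)
         (subst (InRatioClosure p m (suc n′))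
                (sym (trans (cong -_ (ℤ.pos-* ((p ℕ.^ q) ℕ.^ suc n′) (p ℕ.^ ρ ℕ.* u)))
                            (ℤ.neg-distribʳ-* (+ ((p ℕ.^ q) ℕ.^ suc n′)) (+ (p ℕ.^ ρ ℕ.* u)))))
                (InRatioClosure-scale {m} {suc n′} { - + (p ℕ.^ ρ ℕ.* u)} (p ℕ.^ q) (proj₂ (units ρ u ρ<n p∤u))))

-- Used with n = 2^k, L = 2k+1 and K = k+2: every residue ≡ 1 (mod 2^(k+2)) is an odd n-th power
-- modulo 2^(2k+1), which is the precision Hensel's lemma needs.
OddPowerResidues : ℕ → ℕ → ℕ → Set
OddPowerResidues n L K =
  ∀ {ρ} → ρ < 2 ℕ.^ L → ρ ℕ.% 2 ℕ.^ K ≡ 1 → ∃[ y ] (y < 2 ℕ.^ L × y ℕ.% 2 ≡ 1 × y ℕ.^ n ℕ.% 2 ℕ.^ L ≡ ρ)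
  where instance _ = ℕ.m^n≢0 2 L
                 _ = ℕ.m^n≢0 2 K

oddPowerResidues? : ∀ n L K → Dec (OddPowerResidues n L K)
oddPowerResidues? n L K =
  ℕ.allUpTo? (λ ρ → (ρ ℕ.% 2 ℕ.^ K ℕ.≟ 1) →-dec
    ℕ.anyUpTo? (λ y → (y ℕ.% 2 ℕ.≟ 1) ×-dec (y ℕ.^ n ℕ.% 2 ℕ.^ L ℕ.≟ ρ)) (2 ℕ.^ L)) (2 ℕ.^ L)
  where instance _ = ℕ.m^n≢0 2 L
                 _ = ℕ.m^n≢0 2 K

module _ where
  open import Data.Integer.Base using (_+_; _-_; _*_; _^_; -_)
  open import Data.Integer.Divisibility.Signed using (_∣_; divides)
  open import Data.Integer.Tactic.RingSolver using (solve-∀)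

  %≡1⇒¬2∣ : ∀ {y} → y ℕ.% 2 ≡ 1 → ¬ + 2 ∣ + y
  %≡1⇒¬2∣ {y} y%2≡1 2∣y with () ← trans (sym y%2≡1) (ℕ.n∣m⇒m%n≡0 y 2 (pos∣⇒∣ 2∣y))

  ∣ρ-1⇒ρ%K≡1 : ∀ {K} .{{_ : NonZero K}} {ρ} → 1 < K → + K ∣ + ρ - + 1 → ρ ℕ.% K ≡ 1
  ∣ρ-1⇒ρ%K≡1 {K} {zero} 1<K K∣-1 with () ← ℕ.<⇒≢ 1<K (sym (ℕ.∣1⇒≡1 (pos∣⇒∣ K∣-1)))
  ∣ρ-1⇒ρ%K≡1 {K} {suc ρ} 1<K K∣ρ =
    trans (ℕ.%-remove-+ʳ 1 (pos∣⇒∣ (subst (+ K ∣_) (trans (cong (_- + 1) (ℤ.pos-+ 1 ρ)) (cancel (+ ρ))) K∣ρ)))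
          (ℕ.m<n⇒m%n≡m 1<K)
    where
    cancel : ∀ x → + 1 + x - + 1 ≡ x
    cancel = solve-∀

  odd-root-mod-2^ : ∀ {n L K} → K ≤ L → 1 ≤ K → OddPowerResidues n L K →
    ∀ A → + (2 ℕ.^ K) ∣ A - + 1 → ∃[ y ] (¬ + 2 ∣ y × + (2 ℕ.^ L) ∣ A - y ^ n)
  odd-root-mod-2^ {n} {L} {K} K≤L 1≤K residues A 2^K∣A-1 =
    let (y , _ , y%2≡1 , yⁿ%2^L≡ρ) = residues (ℤ.n%ℕd<d A (2 ℕ.^ L)) ρ%2^K≡1
        t = y ℕ.^ n ℕ./ 2 ℕ.^ L
        yⁿ≡ρ+t2^L : (+ y) ^ n ≡ + ρ + + t * + (2 ℕ.^ L)
        yⁿ≡ρ+t2^L = trans (sym (pos-^ y n))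
                     (trans (cong +_ (trans (ℕ.m≡m%n+[m/n]*n (y ℕ.^ n) (2 ℕ.^ L)) (cong (ℕ._+ t ℕ.* 2 ℕ.^ L) yⁿ%2^L≡ρ)))
                            (trans (ℤ.pos-+ ρ _) (cong (λ w → + ρ + w) (ℤ.pos-* t _))))
    in + y , %≡1⇒¬2∣ y%2≡1 ,
       divides (q - + t) (trans (cong₂ _-_ A≡ρ+q2^L yⁿ≡ρ+t2^L) (cancel (+ ρ) q (+ t) (+ (2 ℕ.^ L))))
    where
    instance _ = ℕ.m^n≢0 2 L
             _ = ℕ.m^n≢0 2 K
    ρ = A ℤ.%ℕ 2 ℕ.^ L
    q = A ℤ./ℕ 2 ℕ.^ L
    A≡ρ+q2^L : A ≡ + ρ + q * + (2 ℕ.^ L)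
    A≡ρ+q2^L = ℤ.a≡a%ℕn+[a/ℕn]*n A (2 ℕ.^ L)
    ρ%2^K≡1 : ρ ℕ.% 2 ℕ.^ K ≡ 1
    ρ%2^K≡1 = ∣ρ-1⇒ρ%K≡1 (ℕ.^-monoʳ-≤ 2 1≤K)
      (subst (+ (2 ℕ.^ K) ∣_) (trans (cong (λ z → z - + 1 - q * + (2 ℕ.^ L)) A≡ρ+q2^L) (drop (+ ρ) q (+ (2 ℕ.^ L))))
        (ℤ.∣m∣n⇒∣m-n 2^K∣A-1 (ℤ.∣n⇒∣m*n q (∣⇒pos∣ (^-monoʳ-∣ 2 K≤L)))))
      where
      drop : ∀ r q M → r + q * M - + 1 - q * M ≡ r - + 1
      drop = solve-∀
    cancel : ∀ r q t M → r + q * M - (r + t * M) ≡ (q - t) * M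
    cancel = solve-∀

  2-adic-hensel⇒InClosure : ∀ k {n′ m t} → 1 ≤ k → suc n′ ≡ 2 ℕ.^ k → OddPowerResidues (suc n′) (2 ℕ.* k ℕ.+ 1) (k ℕ.+ 2) →
    (Y : Fin t → ℤ) → suc t ≤ m → ∀ c → + (2 ℕ.^ (k ℕ.+ 2)) ∣ c - sumℤ (suc t) (λ i → (+ 1 ∷ Y) i ^ suc n′) →
    InClosure 2 m (suc n′) c
  2-adic-hensel⇒InClosure k {n′} {m} {t} 1≤k n≡2^k residues Y 1+t≤m c 2^K∣c-Σ =
    let (y , 2∤y , 2^L∣A-yⁿ) = odd-root-mod-2^ {n} {2 ℕ.* k ℕ.+ 1} {k ℕ.+ 2} K≤L (ℕ.≤-trans 1≤k (ℕ.m≤m+n k 2)) residues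
                                               A (subst (_ ∣_) c-Σ≡A-1 2^K∣c-Σ)
    in InClosure-mono {2} {suc t} {m} {n′} {c} 1+t≤m
         (hensel⇒InClosure prime[2] k (trans n≡2^k (sym (ℕ.*-identityʳ _))) (p∤1 prime[2]) (y ∷ Y) zero 2∤y c
           (subst (+ (2 ℕ.^ (2 ℕ.* k ℕ.+ 1)) ∣_) (regroup c (y ^ n) S) 2^L∣A-yⁿ))
    where
    n = suc n′
    S = sumℤ t (λ i → Y i ^ n)
    A = c - S
    K≤L : k ℕ.+ 2 ≤ 2 ℕ.* k ℕ.+ 1
    K≤L = subst (k ℕ.+ 2 ≤_) (trans (ℕ.+-suc k k) (trans (cong (λ z → suc (k ℕ.+ z)) (sym (ℕ.+-identityʳ k))) (ℕ.+-comm 1 _)))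
                (ℕ.+-monoʳ-≤ k (s≤s 1≤k))
    c-Σ≡A-1 : c - ((+ 1) ^ n + S) ≡ A - + 1
    c-Σ≡A-1 = trans (cong (λ z → c - (z + S)) (ℤ.^-zeroˡ n)) (swap c S)
      where
      swap : ∀ c S → c - (+ 1 + S) ≡ c - S - + 1
      swap = solve-∀
    regroup : ∀ c a S → c - S - a ≡ c - (a + S)
    regroup = solve-∀

  sumℤ-ones : ∀ m n → sumℤ m (λ _ → (+ 1) ^ n) ≡ + m
  sumℤ-ones zero    n = refl
  sumℤ-ones (suc m) n = trans (cong₂ _+_ (ℤ.^-zeroˡ n) (sumℤ-ones m n)) (sym (ℤ.pos-+ 1 m))

  2-adic-ones⇒InClosure : ∀ k {n′ m} → 1 ≤ k → suc n′ ≡ 2 ℕ.^ k → OddPowerResidues (suc n′) (2 ℕ.* k ℕ.+ 1) (k ℕ.+ 2) →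
    ∀ j → 1 ≤ j → j ≤ m → ∀ c → + (2 ℕ.^ (k ℕ.+ 2)) ∣ c - + j → InClosure 2 m (suc n′) c
  2-adic-ones⇒InClosure k {n′} 1≤k n≡2^k residues (suc t) _ j≤m c 2^K∣c-j =
    2-adic-hensel⇒InClosure k 1≤k n≡2^k residues (const (+ 1)) j≤m c
      (subst (λ z → + (2 ℕ.^ (k ℕ.+ 2)) ∣ c - z) (sym (sumℤ-ones (suc t) (suc n′))) 2^K∣c-j)

  odd⇒±K*u≡K : ∀ K {u} → ¬ 2 ℕ.∣ u → + (2 ℕ.* K) ∣ + (K ℕ.* u) - + K × + (2 ℕ.* K) ∣ - + (K ℕ.* u) - + K
  odd⇒±K*u≡K K 2∤u with odd⇒≡1+2w 2∤u
  ... | w , refl = divides (+ w) (trans (cong (_- + K) Ku≡) (trans (plus (+ K) (+ w)) (cong (+ w *_) 2K≡))) ,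
                   divides (- + w - + 1) (trans (cong (λ z → - z - + K) Ku≡) (trans (minus (+ K) (+ w)) (cong ((- + w - + 1) *_) 2K≡)))
    where
    2K≡ : + 2 * + K ≡ + (2 ℕ.* K)
    2K≡ = sym (ℤ.pos-* 2 K)
    Ku≡ : + (K ℕ.* (1 ℕ.+ w ℕ.* 2)) ≡ + K * (+ 1 + + w * + 2)
    Ku≡ = trans (ℤ.pos-* K _) (cong (+ K *_) (trans (ℤ.pos-+ 1 (w ℕ.* 2)) (cong (λ z → + 1 + z) (ℤ.pos-* w 2))))
    plus : ∀ K w → K * (+ 1 + w * + 2) - K ≡ w * (+ 2 * K)
    plus = solve-∀
    minus : ∀ K w → - (K * (+ 1 + w * + 2)) - K ≡ (- w - + 1) * (+ 2 * K)
    minus = solve-∀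

  shift⇒InRatioClosure± : ∀ {p m n′} .{{_ : NonZero p}} s ρ u → ρ ≤ s → p ℕ.^ s ≤ m →
    InClosure p m (suc n′) (+ (p ℕ.^ s ℕ.* u)) → InClosure p m (suc n′) (- + (p ℕ.^ s ℕ.* u)) →
    InRatioClosure± p m (suc n′) (p ℕ.^ ρ ℕ.* u)
  shift⇒InRatioClosure± {p} {m} {n′} s ρ u ρ≤s p^s≤m +∈S̄ -∈S̄ =
    (b , b∈S , b≢0 , subst (InClosure p m (suc n′)) (sym +x*b≡) +∈S̄) ,
    (b , b∈S , b≢0 , subst (InClosure p m (suc n′)) (sym (trans (sym (ℤ.neg-distribˡ-* (+ (p ℕ.^ ρ ℕ.* u)) (+ b))) (cong -_ +x*b≡))) -∈S̄)
    where
    b = p ℕ.^ (s ℕ.∸ ρ)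
    b∈S : InS m (suc n′) b
    b∈S = InS-≤ {n = n′} (ℕ.≤-trans (ℕ.^-monoʳ-≤ p (ℕ.m∸n≤m s ρ)) p^s≤m)
    b≢0 = ℕ.m^n≢0 p (s ℕ.∸ ρ)
    +x*b≡ : + (p ℕ.^ ρ ℕ.* u) * + b ≡ + (p ℕ.^ s ℕ.* u)
    +x*b≡ = trans (sym (ℤ.pos-* (p ℕ.^ ρ ℕ.* u) b)) (cong +_ (begin
      p ℕ.^ ρ ℕ.* u ℕ.* b                ≡⟨ ℕ.*-assoc (p ℕ.^ ρ) u b ⟩
      p ℕ.^ ρ ℕ.* (u ℕ.* b)              ≡⟨ cong (p ℕ.^ ρ ℕ.*_) (ℕ.*-comm u b) ⟩
      p ℕ.^ ρ ℕ.* (b ℕ.* u)              ≡⟨ ℕ.*-assoc (p ℕ.^ ρ) b u ⟨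
      p ℕ.^ ρ ℕ.* b ℕ.* u                ≡⟨ cong (ℕ._* u) (ℕ.^-distribˡ-+-* p ρ (s ℕ.∸ ρ)) ⟨
      p ℕ.^ (ρ ℕ.+ (s ℕ.∸ ρ)) ℕ.* u      ≡⟨ cong (λ e → p ℕ.^ e ℕ.* u) (ℕ.m+[n∸m]≡n ρ≤s) ⟩
      p ℕ.^ s ℕ.* u                      ∎))
      where open ≡-Reasoning

  dense-2-4 : ∀ {m} → 8 ≤ m → DenseInQp 2 m 4
  dense-2-4 {m} 8≤m = InRatioClosure⇒Dense prime[2] {m} {3} (InRatioClosure-reduction prime[2] {m} {3} (ℕ.≤-trans (s≤s z≤n) 8≤m) units)
    where
    residues : OddPowerResidues 4 5 4
    residues = toWitness {a? = oddPowerResidues? 4 5 4} tt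
    units : ∀ ρ u → ρ < 4 → ¬ 2 ℕ.∣ u → InRatioClosure± 2 m 4 (2 ℕ.^ ρ ℕ.* u)
    units ρ u ρ<4 2∤u =
      let closure = 2-adic-ones⇒InClosure 2 (s≤s z≤n) refl residues 8 (s≤s z≤n) 8≤m
          (+8u≡8 , -8u≡8) = odd⇒±K*u≡K 8 2∤u
      in shift⇒InRatioClosure± {2} {m} {3} 3 ρ u (ℕ.≤-pred ρ<4) 8≤m (closure (+ (8 ℕ.* u)) +8u≡8) (closure (- + (8 ℕ.* u)) -8u≡8)

  dense-2-16 : ∀ {m} → 64 ≤ m → DenseInQp 2 m 16
  -- 64 ≡ 0 (mod 2^6), so X·2^16 ≡ 64·1^16 for every X.
  dense-2-16 {m} 64≤m = InRatioClosure⇒Dense prime[2] {m} {15} λ X →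
    2 ℕ.^ 16 ℕ.* 1 , InS-scale {m} {16} 2 (InS-≤ {n = 15} (ℕ.≤-trans (s≤s z≤n) 64≤m)) , _ ,
    2-adic-ones⇒InClosure 4 (s≤s z≤n) refl residues 64 (s≤s z≤n) 64≤m (X * + 65536)
      (divides (X * + 1024 - + 1) (rearrange X))
    where
    residues : OddPowerResidues 16 9 6
    residues = toWitness {a? = oddPowerResidues? 16 9 6} tt
    rearrange : ∀ X → X * + 65536 - + 64 ≡ (X * + 1024 - + 1) * + 64
    rearrange = solve-∀

  2u≡ : ∀ r {u} → u ≡ r ℕ.+ u ℕ./ 4 ℕ.* 4 → + (2 ℕ.* u) ≡ + 2 * (+ r + + (u ℕ./ 4) * + 4)
  2u≡ r {u} u≡ = trans (cong (λ z → + (2 ℕ.* z)) u≡)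
                       (trans (ℤ.pos-* 2 (r ℕ.+ u ℕ./ 4 ℕ.* 4))
                              (cong (+ 2 *_) (trans (ℤ.pos-+ r (u ℕ./ 4 ℕ.* 4)) (cong (λ z → + r + z) (ℤ.pos-* (u ℕ./ 4) 4)))))

  odd⇒±2u≡2∨6 : ∀ {u} → ¬ 2 ℕ.∣ u →
    (+ 8 ∣ + (2 ℕ.* u) - + 2 × + 8 ∣ - + (2 ℕ.* u) - + 6) ⊎ (+ 8 ∣ + (2 ℕ.* u) - + 6 × + 8 ∣ - + (2 ℕ.* u) - + 2)
  odd⇒±2u≡2∨6 {u} 2∤u with u ℕ.% 4 | ℕ.m≡m%n+[m/n]*n u 4 | ℕ.m%n<n u 4
  ... | 0 | u≡ | _ = ⊥-elim (2∤u (ℕ.divides (u ℕ./ 4 ℕ.* 2) (trans u≡ (sym (ℕ.*-assoc (u ℕ./ 4) 2 2)))))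
  ... | 2 | u≡ | _ = ⊥-elim (2∤u (ℕ.divides (1 ℕ.+ u ℕ./ 4 ℕ.* 2) (trans u≡ (cong (2 ℕ.+_) (sym (ℕ.*-assoc (u ℕ./ 4) 2 2))))))
  ... | 1 | u≡ | _ = inj₁ (divides (+ q) (trans (cong (_- + 2) (2u≡ 1 u≡)) (case₁ (+ q))) ,
                           divides (- + q - + 1) (trans (cong (λ z → - z - + 6) (2u≡ 1 u≡)) (case₂ (+ q))))
    where
    q = u ℕ./ 4
    case₁ : ∀ q → + 2 * (+ 1 + q * + 4) - + 2 ≡ q * + 8
    case₁ = solve-∀
    case₂ : ∀ q → - (+ 2 * (+ 1 + q * + 4)) - + 6 ≡ (- q - + 1) * + 8
    case₂ = solve-∀
  ... | 3 | u≡ | _ = inj₂ (divides (+ q) (trans (cong (_- + 6) (2u≡ 3 u≡)) (case₁ (+ q))) ,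
                           divides (- + q - + 1) (trans (cong (λ z → - z - + 2) (2u≡ 3 u≡)) (case₂ (+ q))))
    where
    q = u ℕ./ 4
    case₁ : ∀ q → + 2 * (+ 3 + q * + 4) - + 6 ≡ q * + 8
    case₁ = solve-∀
    case₂ : ∀ q → - (+ 2 * (+ 3 + q * + 4)) - + 2 ≡ (- q - + 1) * + 8
    case₂ = solve-∀
  ... | suc (suc (suc (suc _))) | _ | s≤s (s≤s (s≤s (s≤s ())))

  dense-2-2 : ∀ {m} → 3 ≤ m → DenseInQp 2 m 2
  dense-2-2 {m} 3≤m = InRatioClosure⇒Dense prime[2] {m} {1} (InRatioClosure-reduction prime[2] {m} {1} (ℕ.≤-trans (s≤s z≤n) 3≤m) units)
    where
    residues : OddPowerResidues 2 3 3
    residues = toWitness {a? = oddPowerResidues? 2 3 3} tt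
    2≤m = ℕ.≤-trans (ℕ.n≤1+n 2) 3≤m
    ≡1+1⇒∈S̄ : ∀ c → + 8 ∣ c - + 2 → InClosure 2 m 2 c
    ≡1+1⇒∈S̄ = 2-adic-ones⇒InClosure 1 (s≤s z≤n) refl residues 2 (s≤s z≤n) 2≤m
    ≡1+1+4⇒∈S̄ : ∀ c → + 8 ∣ c - + 6 → InClosure 2 m 2 c
    ≡1+1+4⇒∈S̄ = 2-adic-hensel⇒InClosure 1 (s≤s z≤n) refl residues (+ 1 ∷ const (+ 2)) 3≤m
    units : ∀ ρ u → ρ < 2 → ¬ 2 ℕ.∣ u → InRatioClosure± 2 m 2 (2 ℕ.^ ρ ℕ.* u)
    units ρ u ρ<2 2∤u with odd⇒±2u≡2∨6 2∤u
    ... | inj₁ (+2u≡2 , -2u≡6) =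
      shift⇒InRatioClosure± {2} {m} {1} 1 ρ u (ℕ.≤-pred ρ<2) 2≤m (≡1+1⇒∈S̄ (+ (2 ℕ.* u)) +2u≡2) (≡1+1+4⇒∈S̄ (- + (2 ℕ.* u)) -2u≡6)
    ... | inj₂ (+2u≡6 , -2u≡2) =
      shift⇒InRatioClosure± {2} {m} {1} 1 ρ u (ℕ.≤-pred ρ<2) 2≤m (≡1+1+4⇒∈S̄ (+ (2 ℕ.* u)) +2u≡6) (≡1+1⇒∈S̄ (- + (2 ℕ.* u)) -2u≡2)

-- For X = x·2^ρ with 5 ≤ ρ ≤ 7 take b = z^8 + (2^s - 1)·1^8 = 2^s·w with s = 8 - ρ, so that
-- X·b = 2^8·x·w; the table supplies z with x·w ≡ j (mod 32), 1 ≤ j ≤ 16, a sum of j odd 8th powers.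
octic-witness : ℕ → ℕ → ℕ
octic-witness s z = z ℕ.^ 8 ℕ.+ (2 ℕ.^ s ℕ.∸ 1)

octic-residue : ℕ → ℕ → ℕ → ℕ
octic-residue s U z = U ℕ.* (octic-witness s z ℕ./ 2 ℕ.^ s) ℕ.% 32
  where instance _ = ℕ.m^n≢0 2 s

OcticTable : ℕ → Set
OcticTable s = ∀ {U} → U < 32 → U ℕ.% 2 ≡ 1 →
  ∃[ z ] (z < 16 × z ℕ.% 2 ≡ 1 × 2 ℕ.^ s ℕ.∣ octic-witness s z × 1 ≤ octic-residue s U z × octic-residue s U z ≤ 16)

OcticTables : Set
OcticTables = ∀ {s} → s < 4 → 1 ≤ s → OcticTable s

octicTables? : Dec OcticTables
octicTables? = ℕ.allUpTo? (λ s → (1 ℕ.≤? s) →-dec ℕ.allUpTo? (λ U → (U ℕ.% 2 ℕ.≟ 1) →-dec ℕ.anyUpTo? (λ z →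
  (z ℕ.% 2 ℕ.≟ 1) ×-dec (2 ℕ.^ s ℕ.∣? octic-witness s z) ×-dec (1 ℕ.≤? octic-residue s U z) ×-dec (octic-residue s U z ℕ.≤? 16))
  16) 32) 4

module _ where
  open import Data.Integer.Base using (_+_; _-_; _*_; _^_; -_)
  open import Data.Integer.Divisibility.Signed using (_∣_; divides)
  open import Data.Integer.Tactic.RingSolver using (solve-∀)

  octic-witness∈S : ∀ {m} s z → 2 ℕ.^ s ≤ m → InS m 8 (octic-witness s z)
  octic-witness∈S {m} s z 2^s≤m with 2 ℕ.^ s | ℕ.m^n≢0 2 s
  ... | suc t | _ = InS-mono {n = 7} 2^s≤m ((z ∷ const 1) , cong (z ℕ.^ 8 ℕ.+_) (sym (sumℕ-ones t 8)))

  ∣x*w-[x%K*w]%K : ∀ K .{{_ : NonZero K}} x w → + K ∣ x * + w - + (x ℤ.%ℕ K ℕ.* w ℕ.% K)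
  ∣x*w-[x%K*w]%K K x w = divides (+ q + t * + w) (begin
    x * + w - + r                             ≡⟨ cong (λ y → y * + w - + r) (ℤ.a≡a%ℕn+[a/ℕn]*n x K) ⟩
    (+ U + t * + K) * + w - + r               ≡⟨ expand (+ U) t (+ K) (+ w) (+ r) ⟩
    + U * + w + t * + w * + K - + r           ≡⟨ cong (λ y → y + t * + w * + K - + r) Uw≡ ⟩
    + r + + q * + K + t * + w * + K - + r     ≡⟨ collect (+ r) (+ q) t (+ w) (+ K) ⟩
    (+ q + t * + w) * + K                     ∎)
    where
    open ≡-Reasoning
    U = x ℤ.%ℕ K
    t = x ℤ./ℕ K
    r = U ℕ.* w ℕ.% K
    q = U ℕ.* w ℕ./ K
    Uw≡ : + U * + w ≡ + r + + q * + K
    Uw≡ = trans (sym (ℤ.pos-* U w)) (trans (cong +_ (ℕ.m≡m%n+[m/n]*n (U ℕ.* w) K)) (trans (ℤ.pos-+ r _) (cong (λ y → + r + y) (ℤ.pos-* q K))))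
    expand : ∀ U t K w r → (U + t * K) * w - r ≡ U * w + t * w * K - r
    expand = solve-∀
    collect : ∀ r q t w K → r + q * K + t * w * K - r ≡ (q + t * w) * K
    collect = solve-∀

  odd-x*2^ρ∈R̄ : ∀ {m} → 16 ≤ m → ∀ ρ s → ρ ℕ.+ s ≡ 8 → s ≤ 3 → OcticTable s →
    ∀ x → ¬ + 2 ∣ x → InRatioClosure 2 m 8 (x * + (2 ℕ.^ ρ))
  odd-x*2^ρ∈R̄ {m} 16≤m ρ s ρ+s≡8 s≤3 table x 2∤x = from-witness (table {U} (ℤ.n%ℕd<d x 32) U%2≡1)
    where
    instance _ = ℕ.m^n≢0 2 s
    U = x ℤ.%ℕ 32
    U%2≡1 : U ℕ.% 2 ≡ 1
    U%2≡1 with odd⇒≡1+2w {U} (λ 2∣U → 2∤x (subst (+ 2 ∣_) (sym (ℤ.a≡a%ℕn+[a/ℕn]*n x 32))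
                                               (ℤ.∣m∣n⇒∣m+n (∣⇒pos∣ 2∣U) (ℤ.∣n⇒∣m*n (x ℤ./ℕ 32) (divides (+ 16) refl)))))
    ... | w , U≡ = trans (cong (ℕ._% 2) U≡) (ℕ.%-remove-+ʳ 1 {w ℕ.* 2} (ℕ.n∣m*n w))
    residues : OddPowerResidues 8 7 5
    residues = toWitness {a? = oddPowerResidues? 8 7 5} tt

    from-witness : ∃[ z ] (z < 16 × z ℕ.% 2 ≡ 1 × 2 ℕ.^ s ℕ.∣ octic-witness s z × 1 ≤ octic-residue s U z × octic-residue s U z ≤ 16) →
                   InRatioClosure 2 m 8 (x * + (2 ℕ.^ ρ))
    from-witness (z , _ , z%2≡1 , 2^s∣b , 1≤j , j≤16) =
      b , octic-witness∈S s z (ℕ.≤-trans (ℕ.^-monoʳ-≤ 2 s≤3) (ℕ.≤-trans (ℕ.m≤m+n 8 8) 16≤m)) , b≢0 ,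
      subst (InClosure 2 m 8) 2⁸xw≡x2^ρb (InClosure-scale {2} {m} {8} {x * + w} 2 xw∈S̄)
      where
      b = octic-witness s z
      w = b ℕ./ 2 ℕ.^ s
      b≢0 : NonZero b
      b≢0 = ℕ.>-nonZero (ℕ.≤-trans (ℕ.m^n>0 z {{z≢0}} 8) (ℕ.m≤m+n (z ℕ.^ 8) _))
        where
        z≢0 : NonZero z
        z≢0 = ℕ.≢-nonZero λ z≡0 → ℕ.0≢1+n (trans (sym (cong (ℕ._% 2) z≡0)) z%2≡1)
      xw∈S̄ : InClosure 2 m 8 (x * + w)
      xw∈S̄ = 2-adic-ones⇒InClosure 3 (s≤s z≤n) refl residues _ 1≤j (ℕ.≤-trans j≤16 16≤m) (x * + w) (∣x*w-[x%K*w]%K 32 x w)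
      2⁸xw≡x2^ρb : + (2 ℕ.^ 8) * (x * + w) ≡ x * + (2 ℕ.^ ρ) * + b
      2⁸xw≡x2^ρb = begin
        + (2 ℕ.^ 8) * (x * + w)                   ≡⟨ cong (λ e → + (2 ℕ.^ e) * (x * + w)) ρ+s≡8 ⟨
        + (2 ℕ.^ (ρ ℕ.+ s)) * (x * + w)           ≡⟨ cong (_* (x * + w)) (pos-^-+ 2 ρ s) ⟩
        + (2 ℕ.^ ρ) * + (2 ℕ.^ s) * (x * + w)     ≡⟨ rearrange (+ (2 ℕ.^ ρ)) (+ (2 ℕ.^ s)) x (+ w) ⟩
        x * + (2 ℕ.^ ρ) * (+ w * + (2 ℕ.^ s))     ≡⟨ cong (x * + (2 ℕ.^ ρ) *_) (trans (sym (ℤ.pos-* w _)) (cong +_ (ℕ.m/n*n≡m 2^s∣b))) ⟩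
        x * + (2 ℕ.^ ρ) * + b                     ∎
        where
        open ≡-Reasoning
        rearrange : ∀ P Q x w → P * Q * (x * w) ≡ x * P * (w * Q)
        rearrange = solve-∀

  dense-2-8 : ∀ {m} → 16 ≤ m → DenseInQp 2 m 8
  dense-2-8 {m} 16≤m = InRatioClosure⇒Dense prime[2] {m} {7} (InRatioClosure-reduction prime[2] {m} {7} (ℕ.≤-trans (s≤s z≤n) 16≤m) units)
    where
    residues : OddPowerResidues 8 7 5
    residues = toWitness {a? = oddPowerResidues? 8 7 5} tt

    small : ∀ ρ u → ρ ≤ 4 → ¬ 2 ℕ.∣ u → InRatioClosure± 2 m 8 (2 ℕ.^ ρ ℕ.* u)
    small ρ u ρ≤4 2∤u =
      let closure = 2-adic-ones⇒InClosure 3 (s≤s z≤n) refl residues 16 (s≤s z≤n) 16≤m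
          (+16u≡16 , -16u≡16) = odd⇒±K*u≡K 16 2∤u
      in shift⇒InRatioClosure± {2} {m} {7} 4 ρ u ρ≤4 16≤m (closure (+ (16 ℕ.* u)) +16u≡16) (closure (- + (16 ℕ.* u)) -16u≡16)

    large : ∀ ρ s → ρ ℕ.+ s ≡ 8 → s ≤ 3 → OcticTable s → ∀ u → ¬ 2 ℕ.∣ u → InRatioClosure± 2 m 8 (2 ℕ.^ ρ ℕ.* u)
    large ρ s ρ+s≡8 s≤3 table u 2∤u =
      subst (InRatioClosure 2 m 8) +u*2^ρ≡ (odd-x*2^ρ∈R̄ 16≤m ρ s ρ+s≡8 s≤3 table (+ u) 2∤+u) ,
      subst (InRatioClosure 2 m 8) (trans (sym (ℤ.neg-distribˡ-* (+ u) _)) (cong -_ +u*2^ρ≡))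
            (odd-x*2^ρ∈R̄ 16≤m ρ s ρ+s≡8 s≤3 table (- + u) (λ 2∣-u → 2∤+u (subst (+ 2 ∣_) (ℤ.neg-involutive (+ u)) (ℤ.∣m⇒∣-m 2∣-u))))
      where
      2∤+u : ¬ + 2 ∣ + u
      2∤+u 2∣u = 2∤u (pos∣⇒∣ 2∣u)
      +u*2^ρ≡ : + u * + (2 ℕ.^ ρ) ≡ + (2 ℕ.^ ρ ℕ.* u)
      +u*2^ρ≡ = trans (sym (ℤ.pos-* u _)) (cong +_ (ℕ.*-comm u _))

    units : ∀ ρ u → ρ < 8 → ¬ 2 ℕ.∣ u → InRatioClosure± 2 m 8 (2 ℕ.^ ρ ℕ.* u)
    units ρ u ρ<8 2∤u with ρ ℕ.≤? 4
    ... | yes ρ≤4 = small ρ u ρ≤4 2∤u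
    ... | no ρ≰4  = large ρ (8 ℕ.∸ ρ) (ℕ.m+[n∸m]≡n (ℕ.<⇒≤ ρ<8)) s≤3
                      (toWitness {a? = octicTables?} tt (ℕ.≤-<-trans s≤3 ℕ.≤-refl) (ℕ.m<n⇒0<n∸m ρ<8)) u 2∤u
      where
      s≤3 : 8 ℕ.∸ ρ ≤ 3
      s≤3 = ℕ.∸-monoʳ-≤ 8 (ℕ.≰⇒> ρ≰4)

-- p = 2: non-density

PowerParity : (K n : ℕ) → .{{NonZero K}} → Set
PowerParity K n = ∀ {y} → y < K → y ℕ.^ n ℕ.% K ≡ y ℕ.% 2

powerParity? : ∀ K n .{{_ : NonZero K}} → Dec (PowerParity K n)
powerParity? K n = ℕ.allUpTo? (λ y → y ℕ.^ n ℕ.% K ℕ.≟ y ℕ.% 2) K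

Residue125 : ℕ → Set
Residue125 r = r ≡ 1 ⊎ r ≡ 2 ⊎ r ≡ 5

TwoSquaresMod8 : Set
TwoSquaresMod8 = ∀ {a} → a < 8 → ∀ {b} → b < 8 → a ℕ.% 2 ≡ 1 ⊎ b ℕ.% 2 ≡ 1 → Residue125 ((a ℕ.^ 2 ℕ.+ b ℕ.^ 2) ℕ.% 8)

twoSquaresMod8? : Dec TwoSquaresMod8
twoSquaresMod8? = ℕ.allUpTo? (λ a → ℕ.allUpTo? (λ b →
  ((a ℕ.% 2 ℕ.≟ 1) ⊎-dec (b ℕ.% 2 ℕ.≟ 1)) →-dec residue125? ((a ℕ.^ 2 ℕ.+ b ℕ.^ 2) ℕ.% 8)) 8) 8
  where
  residue125? : ∀ r → Dec (Residue125 r)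
  residue125? r = (r ℕ.≟ 1) ⊎-dec (r ℕ.≟ 2) ⊎-dec (r ℕ.≟ 5)

module _ where
  open import Data.Nat.Base using (_+_; _*_; _^_; _%_; _/_)
  open import Data.Nat.Divisibility using (_∣_; divides)
  open import Data.Nat.Tactic.RingSolver using (solve-∀)

  %-distribˡ-^ : ∀ a n K .{{_ : NonZero K}} → a ^ n % K ≡ (a % K) ^ n % K
  %-distribˡ-^ a zero    K = refl
  %-distribˡ-^ a (suc n) K = begin
    a * a ^ n % K                              ≡⟨ ℕ.%-distribˡ-* a (a ^ n) K ⟩
    (a % K) * (a ^ n % K) % K                  ≡⟨ cong (λ z → (a % K) * z % K) (%-distribˡ-^ a n K) ⟩
    (a % K) * ((a % K) ^ n % K) % K            ≡⟨ cong (λ z → z * ((a % K) ^ n % K) % K) (ℕ.m%n%n≡m%n a K) ⟨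
    (a % K % K) * ((a % K) ^ n % K) % K        ≡⟨ ℕ.%-distribˡ-* (a % K) ((a % K) ^ n) K ⟨
    (a % K) * (a % K) ^ n % K                  ∎
    where open ≡-Reasoning

  odd⇒%2≡1 : ∀ {y} → ¬ 2 ∣ y → y % 2 ≡ 1
  odd⇒%2≡1 2∤y with odd⇒≡1+2w 2∤y
  ... | w , refl = ℕ.%-remove-+ʳ 1 {w * 2} (ℕ.n∣m*n w)

  module _ {K n} .{{_ : NonZero K}} (2∣K : 2 ∣ K) (parity : PowerParity K n) where

    ^%≡%2 : ∀ y → y ^ n % K ≡ y % 2
    ^%≡%2 y = trans (%-distribˡ-^ y n K) (trans (parity (ℕ.m%n<n y K)) (ℕ.m∣n⇒o%n%m≡o%m 2 K y 2∣K))

    sum-powers≡sum-parities : ∀ m (y : Fin m → ℕ) → ∃[ Q ] sumℕ m (λ i → y i ^ n) ≡ sumℕ m (λ i → y i % 2) + Q * K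
    sum-powers≡sum-parities zero    y = 0 , refl
    sum-powers≡sum-parities (suc m) y =
      let (Q , Σ≡) = sum-powers≡sum-parities m (λ i → y (suc i))
          y₀ = y zero
      in y₀ ^ n / K + Q ,
         trans (cong₂ _+_ (trans (ℕ.m≡m%n+[m/n]*n (y₀ ^ n) K) (cong (_+ y₀ ^ n / K * K) (^%≡%2 y₀))) Σ≡)
               (regroup (y₀ % 2) (y₀ ^ n / K) (sumℕ m (λ i → y (suc i) % 2)) Q K)
      where
      regroup : ∀ a q s Q K → a + q * K + (s + Q * K) ≡ a + s + (q + Q) * K
      regroup = solve-∀

    UnitPowerSum⇒≡j+QK : ∀ {m w} → UnitPowerSum 2 m n w → ∃[ j ] ∃[ Q ] (w ≡ j + Q * K × 1 ≤ j × j ≤ m)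
    UnitPowerSum⇒≡j+QK {m} (y , w≡Σ , i , 2∤yi) =
      let (Q , Σ≡) = sum-powers≡sum-parities m y
      in sumℕ m (λ i → y i % 2) , Q , trans w≡Σ Σ≡ ,
         ℕ.≤-trans (ℕ.≤-reflexive (sym (odd⇒%2≡1 2∤yi))) (term≤sumℕ m (λ i → y i % 2) i) ,
         sumℕ≤m m (λ i → y i % 2) (λ i → ℕ.≤-pred (ℕ.m%n<n (y i) 2))
      where
      term≤sumℕ : ∀ m (f : Fin m → ℕ) i → f i ≤ sumℕ m f
      term≤sumℕ (suc m) f zero    = ℕ.m≤m+n (f zero) _
      term≤sumℕ (suc m) f (suc i) = ℕ.≤-trans (term≤sumℕ m (λ j → f (suc j)) i) (ℕ.m≤n+m _ (f zero))
      sumℕ≤m : ∀ m (f : Fin m → ℕ) → (∀ i → f i ≤ 1) → sumℕ m f ≤ m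
      sumℕ≤m zero    f f≤1 = z≤n
      sumℕ≤m (suc m) f f≤1 = ℕ.+-mono-≤ (f≤1 zero) (sumℕ≤m m (λ j → f (suc j)) (λ j → f≤1 (suc j)))

    ∤-small : ∀ {j} → 1 ≤ j → j < K → ¬ K ∣ j
    ∤-small {suc j} _ j<K K∣j = ℕ.<-irrefl refl (ℕ.<-≤-trans j<K (ℕ.∣⇒≤ K∣j))

    UnitPowerSum⇒¬K∣w+Kt : ∀ {m w} → m < K → UnitPowerSum 2 m n w → ∀ t → ¬ K ∣ w + K * t
    UnitPowerSum⇒¬K∣w+Kt m<K w∈U t K∣w+Kt =
      let (j , Q , w≡ , 1≤j , j≤m) = UnitPowerSum⇒≡j+QK w∈U
      in ∤-small 1≤j (ℕ.≤-<-trans j≤m m<K)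
           (ℕ.∣m+n∣m⇒∣n (subst (K ∣_) (trans (cong (_+ K * t) w≡) (swap j (Q * K) (K * t))) K∣w+Kt)
                        (ℕ.∣m∣n⇒∣m+n (ℕ.n∣m*n Q) (ℕ.m∣m*n t)))
      where
      swap : ∀ j a b → j + a + b ≡ a + b + j
      swap = solve-∀

    UnitPowerSums⇒¬K∣w+w′ : ∀ {m w w′} → 2 * m < K → UnitPowerSum 2 m n w → UnitPowerSum 2 m n w′ → ¬ K ∣ w + w′
    UnitPowerSums⇒¬K∣w+w′ {m} 2m<K w∈U w′∈U K∣w+w′ =
      let (j , Q , w≡ , 1≤j , j≤m) = UnitPowerSum⇒≡j+QK w∈U
          (j′ , Q′ , w′≡ , _ , j′≤m) = UnitPowerSum⇒≡j+QK w′∈U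
      in ∤-small (ℕ.≤-trans 1≤j (ℕ.m≤m+n j j′))
                 (ℕ.≤-<-trans (subst (j + j′ ≤_) (cong (_+_ m) (sym (ℕ.+-identityʳ m))) (ℕ.+-mono-≤ j≤m j′≤m)) 2m<K)
           (ℕ.∣m+n∣m⇒∣n (subst (K ∣_) (trans (cong₂ _+_ w≡ w′≡) (swap j (Q * K) j′ (Q′ * K))) K∣w+w′)
                        (ℕ.∣m∣n⇒∣m+n (ℕ.n∣m*n Q) (ℕ.n∣m*n Q′)))
      where
      swap : ∀ j a j′ b → j + a + (j′ + b) ≡ a + b + (j + j′)
      swap = solve-∀

    UnitPowerSum⇒¬K∣w : ∀ {m w} → m < K → UnitPowerSum 2 m n w → ¬ K ∣ w
    UnitPowerSum⇒¬K∣w {w = w} m<K w∈U K∣w =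
      UnitPowerSum⇒¬K∣w+Kt m<K w∈U 0 (subst (K ∣_) (sym (trans (cong (_+_ w) (ℕ.*-zeroʳ K)) (ℕ.+-identityʳ w))) K∣w)

  ¬dense-2-8 : ∀ {m} → m < 16 → ¬ DenseInQp 2 m 8
  ¬dense-2-8 {m} m<16 = 2D≤n⇒¬Dense prime[2] {m} {7} 4 ℕ.≤-refl (λ w → UnitPowerSum⇒¬K∣w {16} {8} (divides 8 refl) parity m<16)
    where
    parity : PowerParity 16 8
    parity = toWitness {a? = powerParity? 16 8} tt

  ¬dense-2-16 : ∀ {m} → m < 64 → ¬ DenseInQp 2 m 16
  ¬dense-2-16 {m} m<64 =
    2D≤n⇒¬Dense prime[2] {m} {15} 6 (ℕ.+-monoʳ-≤ 12 z≤n) (λ w → UnitPowerSum⇒¬K∣w {64} {16} (divides 32 refl) parity m<64)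
    where
    parity : PowerParity 64 16
    parity = toWitness {a? = powerParity? 64 16} tt

  ¬dense-2-4 : ∀ {m} → m < 8 → ¬ DenseInQp 2 m 4
  ¬dense-2-4 {m} m<8 = no-cancellation⇒¬Dense prime[2] {m} {3} 4
    (λ w t w∈U → UnitPowerSum⇒¬K∣w+Kt {16} {4} (divides 8 refl) parity (ℕ.<-trans m<8 (ℕ.+-monoʳ-< 8 (s≤s z≤n))) w∈U t)
    (λ w w′ → UnitPowerSums⇒¬K∣w+w′ {16} {4} (divides 8 refl) parity
                (ℕ.≤-<-trans (ℕ.*-monoʳ-≤ 2 (ℕ.≤-pred m<8)) (ℕ.<-trans (ℕ.n<1+n 14) (ℕ.n<1+n 15))))
    where
    parity : PowerParity 16 4
    parity = toWitness {a? = powerParity? 16 4} tt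

  UnitPowerSum-2-2⇒Residue125 : ∀ {w} → UnitPowerSum 2 2 2 w → Residue125 (w % 8)
  UnitPowerSum-2-2⇒Residue125 (y , refl , i , 2∤yi) =
    subst Residue125 (sym w%8≡) (toWitness {a? = twoSquaresMod8?} tt (ℕ.m%n<n y₀ 8) (ℕ.m%n<n y₁ 8) (unit-residue i 2∤yi))
    where
    y₀ = y zero
    y₁ = y (suc zero)
    w%8≡ : (y₀ ^ 2 + (y₁ ^ 2 + 0)) % 8 ≡ ((y₀ % 8) ^ 2 + (y₁ % 8) ^ 2) % 8
    w%8≡ = begin
      (y₀ ^ 2 + (y₁ ^ 2 + 0)) % 8                  ≡⟨ cong (λ z → (y₀ ^ 2 + z) % 8) (ℕ.+-identityʳ (y₁ ^ 2)) ⟩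
      (y₀ ^ 2 + y₁ ^ 2) % 8                        ≡⟨ ℕ.%-distribˡ-+ (y₀ ^ 2) (y₁ ^ 2) 8 ⟩
      (y₀ ^ 2 % 8 + y₁ ^ 2 % 8) % 8                ≡⟨ cong₂ (λ a b → (a + b) % 8) (%-distribˡ-^ y₀ 2 8) (%-distribˡ-^ y₁ 2 8) ⟩
      ((y₀ % 8) ^ 2 % 8 + (y₁ % 8) ^ 2 % 8) % 8    ≡⟨ ℕ.%-distribˡ-+ ((y₀ % 8) ^ 2) ((y₁ % 8) ^ 2) 8 ⟨
      ((y₀ % 8) ^ 2 + (y₁ % 8) ^ 2) % 8            ∎
      where open ≡-Reasoning
    odd-residue : ∀ {y} → ¬ 2 ∣ y → y % 8 % 2 ≡ 1
    odd-residue {y} 2∤y = trans (ℕ.m∣n⇒o%n%m≡o%m 2 8 y (divides 4 refl)) (odd⇒%2≡1 2∤y)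
    unit-residue : ∀ i → ¬ 2 ∣ y i → y₀ % 8 % 2 ≡ 1 ⊎ y₁ % 8 % 2 ≡ 1
    unit-residue zero          2∤y₀ = inj₁ (odd-residue 2∤y₀)
    unit-residue (suc zero)    2∤y₁ = inj₂ (odd-residue 2∤y₁)

  Residue125-sum≢0 : ∀ {r r′} → Residue125 r → Residue125 r′ → (r + r′) % 8 ≢ 0
  Residue125-sum≢0 (inj₁ refl)        (inj₁ refl)        ()
  Residue125-sum≢0 (inj₁ refl)        (inj₂ (inj₁ refl)) ()
  Residue125-sum≢0 (inj₁ refl)        (inj₂ (inj₂ refl)) ()
  Residue125-sum≢0 (inj₂ (inj₁ refl)) (inj₁ refl)        ()
  Residue125-sum≢0 (inj₂ (inj₁ refl)) (inj₂ (inj₁ refl)) ()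
  Residue125-sum≢0 (inj₂ (inj₁ refl)) (inj₂ (inj₂ refl)) ()
  Residue125-sum≢0 (inj₂ (inj₂ refl)) (inj₁ refl)        ()
  Residue125-sum≢0 (inj₂ (inj₂ refl)) (inj₂ (inj₁ refl)) ()
  Residue125-sum≢0 (inj₂ (inj₂ refl)) (inj₂ (inj₂ refl)) ()

  ¬dense-2-2 : ¬ DenseInQp 2 2 2
  ¬dense-2-2 = no-cancellation⇒¬Dense prime[2] {2} {1} 3
    (λ w t w∈U 8∣w+4t →
       UnitPowerSum⇒¬K∣w+Kt {4} {2} (divides 2 refl) parity (ℕ.m<n+m 2 {2} (s≤s z≤n)) w∈U t (ℕ.∣-trans (divides 2 refl) 8∣w+4t))
    (λ w w′ w∈U w′∈U 8∣w+w′ → Residue125-sum≢0 (UnitPowerSum-2-2⇒Residue125 w∈U) (UnitPowerSum-2-2⇒Residue125 w′∈U)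
                               (trans (sym (ℕ.%-distribˡ-+ w w′ 8)) (ℕ.n∣m⇒m%n≡0 _ 8 8∣w+w′)))
    where
    parity : PowerParity 4 2
    parity = toWitness {a? = powerParity? 4 2} tt

open import Data.Nat.Base using (_+_; _*_; _^_)

threshold⇔ : ∀ {P : Set} {K m} → (K ≤ m → P) → (m < K → ¬ P) → P ⇔ K ≤ m
threshold⇔ dense ¬dense = mk⇔ (λ P → ℕ.≮⇒≥ (λ m<K → ¬dense m<K P)) dense

theorem1p9 : ∀ (m : ℕ) → 2 ≤ m →
      (∀ (n p : ℕ) → 2 ≤ n → Prime p → ∀ (k : ℕ) → IsValuation p n k →
        ∀ (t : ℕ) → IsTheta n (p ^ (2 * k + 1)) t →
          (t ≤ m → DenseInQp p m n)
          × (m < t → ¬ (p ≡ 2 × (n ≡ 2 ⊎ n ≡ 4 ⊎ n ≡ 8 ⊎ n ≡ 16)) → ¬ DenseInQp p m n))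
      × (DenseInQp 2 m 2 ⇔ 3 ≤ m)
      × (DenseInQp 2 m 4 ⇔ 8 ≤ m)
      × (DenseInQp 2 m 8 ⇔ 16 ≤ m)
      × (DenseInQp 2 m 16 ⇔ 64 ≤ m)
theorem1p9 m 2≤m =
    (λ n p 2≤n p-prime k val t θ → θ≤m⇒Dense p-prime {m} {n} {k} 2≤n val θ , m<θ⇒¬Dense p-prime {m} {n} {k} 2≤m 2≤n val θ)
  , threshold⇔ dense-2-2 (λ m<3 → subst (λ m → ¬ DenseInQp 2 m 2) (ℕ.≤-antisym 2≤m (ℕ.≤-pred m<3)) ¬dense-2-2)
  , threshold⇔ dense-2-4 ¬dense-2-4
  , threshold⇔ dense-2-8 ¬dense-2-8
  , threshold⇔ dense-2-16 ¬dense-2-16
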